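{- Let $\Gamma$ and $\Delta$ be multisets of nnf-formulas with $\Delta$ containing at most one formula. For every tree-like $\mathbf{LK}$-proof $\pi$ of $\Gamma\Rightarrow\Delta$ there is a tree-like $G$-proof $\sigma_\pi$ of $\Gamma\Rightarrow\Delta$ with $|\sigma_\pi|\le|\pi|^{O(1)}$.
   Context: An nnf-formula is generated by $F::=p\mid\neg p\mid F_1\wedge F_2\mid F_1\vee F_2$ ($p$ an atom). In $\mathbf{LK}$ it is read as an $\mathcal{L}_p$-formula with $\neg p=p\to\bot$; in $G$ it is read as an $\mathcal{L}_u$-formula with $\neg p=p\to0$. $\mathbf{LK}$ is the classical sequent calculus over $\mathcal{L}_p$ (atoms, $\top,\bot$, $\wedge,\vee,\to$), with sequents $\Gamma\Rightarrow\Delta$ of finite multisets, axioms $A\Rightarrow A$, $\Gamma\Rightarrow\top,\Delta$, $\Gamma,\bot\Rightarrow\Delta$, left/right weakening and contraction, the usual left/right rules for $\wedge,\vee,\to$, and cut. $\mathcal{L}_u$-formulas are built from atoms and constants $0,1$ by $\wedge,\vee,*,\to$. $\mathbf{FL_e}$ is the single-conclusion sequent calculus (sequents $\Gamma\Rightarrow\Delta$, $|\Delta|\le1$) with axioms $A\Rightarrow A$, $\Rightarrow1$, $0\Rightarrow$ and rules: from $\Gamma\Rightarrow\Delta$ infer $\Gamma,1\Rightarrow\Delta$; from $\Gamma\Rightarrow$ infer $\Gamma\Rightarrow0$; from $\Gamma,A_i\Rightarrow\Delta$ infer $\Gamma,A_0\wedge A_1\Rightarrow\Delta$; from $\Gamma\Rightarrow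 A$ and $\Gamma\Rightarrow B$ infer $\Gamma\Rightarrow A\wedge B$; from $\Gamma,A\Rightarrow\Delta$ and $\Gamma,B\Rightarrow\Delta$ infer $\Gamma,A\vee B\Rightarrow\Delta$; from $\Gamma\Rightarrow A_i$ infer $\Gamma\Rightarrow A_0\vee A_1$; from $\Gamma,A,B\Rightarrow\Delta$ infer $\Gamma,A*B\Rightarrow\Delta$; from $\Gamma\Rightarrow A$ and $\Sigma\Rightarrow B$ infer $\Gamma,\Sigma\Rightarrow A*B$; from $\Gamma\Rightarrow A$ and $\Sigma,B\Rightarrow\Lambda$ infer $\Gamma,\Sigma,A\to B\Rightarrow\Lambda$; from $\Gamma,A\Rightarrow B$ infer $\Gamma\Rightarrow A\to B$; cut: from $\Gamma\Rightarrow A$ and $\Sigma,A\Rightarrow\Lambda$ infer $\Gamma,\Sigma\Rightarrow\Lambda$. $G$ is $\mathbf{FL_e}$ plus the additional initial sequents, for every atom $p$: $\Rightarrow p\vee\neg p$, $p\Rightarrow1$, $\neg p\Rightarrow1$, $0\Rightarrow p$, $0\Rightarrow\neg p$, and $0\Rightarrow0*0$ (only for atoms; no substitution instances). A proof is tree-like if every sequent occurrence is used at most once as a premise. Size = number of symbols. -}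

module Defs where

open import Data.Nat using (ℕ; suc; _+_)
open import Data.List using (List; []; _∷_; _++_; map)
open import Data.Nat.ListAction using (sum)
open import Data.List.Relation.Binary.Permutation.Propositional using (_↭_)

Atom : Set
Atom = ℕ

data FmP : Set where
  atP  : Atom → FmP
  ⊤P ⊥P : FmP
  _∧P_ _∨P_ _⇒P_ : FmP → FmP → FmP

data FmU : Set where
  atU  : Atom → FmU
  0U 1U : FmU
  _∧U_ _∨U_ _*U_ _⇒U_ : FmU → FmU → FmU

data NNF : Set where
  pos neg : Atom → NNF
  _∧N_ _∨N_ : NNF → NNF → NNF

¬P : Atom → FmP
¬P p = atP p ⇒P ⊥P

¬U : Atom → FmU
¬U p = atU p ⇒U 0U

toP : NNF → FmP
toP (pos p) = atP p
toP (neg p) = ¬P p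
toP (A ∧N B) = toP A ∧P toP B
toP (A ∨N B) = toP A ∨P toP B

toU : NNF → FmU
toU (pos p) = atU p
toU (neg p) = ¬U p
toU (A ∧N B) = toU A ∧U toU B
toU (A ∨N B) = toU A ∨U toU B

szP : FmP → ℕ
szP (atP _) = 1
szP ⊤P = 1
szP ⊥P = 1
szP (A ∧P B) = suc (szP A + szP B)
szP (A ∨P B) = suc (szP A + szP B)
szP (A ⇒P B) = suc (szP A + szP B)

szU : FmU → ℕ
szU (atU _) = 1
szU 0U = 1
szU 1U = 1
szU (A ∧U B) = suc (szU A + szU B)
szU (A ∨U B) = suc (szU A + szU B)
szU (A *U B) = suc (szU A + szU B)
szU (A ⇒U B) = suc (szU A + szU B)

-- a sequent Γ ⇒ Δ: symbols of all formulas plus one for the arrow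
seqSzP : List FmP → List FmP → ℕ
seqSzP Γ Δ = suc (sum (map szP Γ) + sum (map szP Δ))

seqSzU : List FmU → List FmU → ℕ
seqSzU Γ Δ = suc (sum (map szU Γ) + sum (map szU Δ))

-- LK (tree-like proofs are exactly the elements of this inductive type).
-- Sequents are pairs of lists; the free exchange rule `exLK` makes them
-- multisets and contributes no symbols to the size.

data LK : List FmP → List FmP → Set where
  ax   : ∀ A → LK (A ∷ []) (A ∷ [])
  ax⊤  : ∀ Γ Δ → LK Γ (⊤P ∷ Δ)
  ax⊥  : ∀ Γ Δ → LK (⊥P ∷ Γ) Δ
  exLK : ∀ {Γ Γ' Δ Δ'} → Γ ↭ Γ' → Δ ↭ Δ' → LK Γ Δ → LK Γ' Δ'
  wL   : ∀ {Γ Δ} A → LK Γ Δ → LK (A ∷ Γ) Δ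
  wR   : ∀ {Γ Δ} A → LK Γ Δ → LK Γ (A ∷ Δ)
  cL   : ∀ {Γ Δ A} → LK (A ∷ A ∷ Γ) Δ → LK (A ∷ Γ) Δ
  cR   : ∀ {Γ Δ A} → LK Γ (A ∷ A ∷ Δ) → LK Γ (A ∷ Δ)
  ∧L₀  : ∀ {Γ Δ A} B → LK (A ∷ Γ) Δ → LK ((A ∧P B) ∷ Γ) Δ
  ∧L₁  : ∀ {Γ Δ B} A → LK (B ∷ Γ) Δ → LK ((A ∧P B) ∷ Γ) Δ
  ∧R   : ∀ {Γ Δ A B} → LK Γ (A ∷ Δ) → LK Γ (B ∷ Δ) → LK Γ ((A ∧P B) ∷ Δ)
  ∨L   : ∀ {Γ Δ A B} → LK (A ∷ Γ) Δ → LK (B ∷ Γ) Δ → LK ((A ∨P B) ∷ Γ) Δ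
  ∨R₀  : ∀ {Γ Δ A} B → LK Γ (A ∷ Δ) → LK Γ ((A ∨P B) ∷ Δ)
  ∨R₁  : ∀ {Γ Δ B} A → LK Γ (B ∷ Δ) → LK Γ ((A ∨P B) ∷ Δ)
  ⇒L   : ∀ {Γ Σ Δ Λ A B} → LK Γ (A ∷ Δ) → LK (B ∷ Σ) Λ →
         LK ((A ⇒P B) ∷ (Γ ++ Σ)) (Δ ++ Λ)
  ⇒R   : ∀ {Γ Δ A B} → LK (A ∷ Γ) (B ∷ Δ) → LK Γ ((A ⇒P B) ∷ Δ)
  cut  : ∀ {Γ Σ Δ Λ} A → LK Γ (A ∷ Δ) → LK (A ∷ Σ) Λ → LK (Γ ++ Σ) (Δ ++ Λ)

sizeLK : ∀ {Γ Δ} → LK Γ Δ → ℕ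
sizeLK {Γ} {Δ} (exLK _ _ π) = sizeLK π
sizeLK {Γ} {Δ} (ax _) = seqSzP Γ Δ
sizeLK {Γ} {Δ} (ax⊤ _ _) = seqSzP Γ Δ
sizeLK {Γ} {Δ} (ax⊥ _ _) = seqSzP Γ Δ
sizeLK {Γ} {Δ} (wL _ π) = seqSzP Γ Δ + sizeLK π
sizeLK {Γ} {Δ} (wR _ π) = seqSzP Γ Δ + sizeLK π
sizeLK {Γ} {Δ} (cL π) = seqSzP Γ Δ + sizeLK π
sizeLK {Γ} {Δ} (cR π) = seqSzP Γ Δ + sizeLK π
sizeLK {Γ} {Δ} (∧L₀ _ π) = seqSzP Γ Δ + sizeLK π
sizeLK {Γ} {Δ} (∧L₁ _ π) = seqSzP Γ Δ + sizeLK π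
sizeLK {Γ} {Δ} (∧R π ρ) = seqSzP Γ Δ + sizeLK π + sizeLK ρ
sizeLK {Γ} {Δ} (∨L π ρ) = seqSzP Γ Δ + sizeLK π + sizeLK ρ
sizeLK {Γ} {Δ} (∨R₀ _ π) = seqSzP Γ Δ + sizeLK π
sizeLK {Γ} {Δ} (∨R₁ _ π) = seqSzP Γ Δ + sizeLK π
sizeLK {Γ} {Δ} (⇒L π ρ) = seqSzP Γ Δ + sizeLK π + sizeLK ρ
sizeLK {Γ} {Δ} (⇒R π) = seqSzP Γ Δ + sizeLK π
sizeLK {Γ} {Δ} (cut _ π ρ) = seqSzP Γ Δ + sizeLK π + sizeLK ρ

-- FL_e and G.  Succedents are lists; every rule keeps them of length ≤ 1.

data G : List FmU → List FmU → Set where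
  ax    : ∀ A → G (A ∷ []) (A ∷ [])
  ax1   : G [] (1U ∷ [])
  ax0   : G (0U ∷ []) []
  exG   : ∀ {Γ Γ' Δ} → Γ ↭ Γ' → G Γ Δ → G Γ' Δ
  L1    : ∀ {Γ Δ} → G Γ Δ → G (1U ∷ Γ) Δ
  R0    : ∀ {Γ} → G Γ [] → G Γ (0U ∷ [])
  ∧L₀   : ∀ {Γ Δ A} B → G (A ∷ Γ) Δ → G ((A ∧U B) ∷ Γ) Δ
  ∧L₁   : ∀ {Γ Δ B} A → G (B ∷ Γ) Δ → G ((A ∧U B) ∷ Γ) Δ
  ∧R    : ∀ {Γ A B} → G Γ (A ∷ []) → G Γ (B ∷ []) → G Γ ((A ∧U B) ∷ [])
  ∨L    : ∀ {Γ Δ A B} → G (A ∷ Γ) Δ → G (B ∷ Γ) Δ → G ((A ∨U B) ∷ Γ) Δ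
  ∨R₀   : ∀ {Γ A} B → G Γ (A ∷ []) → G Γ ((A ∨U B) ∷ [])
  ∨R₁   : ∀ {Γ B} A → G Γ (B ∷ []) → G Γ ((A ∨U B) ∷ [])
  *L    : ∀ {Γ Δ A B} → G (A ∷ B ∷ Γ) Δ → G ((A *U B) ∷ Γ) Δ
  *R    : ∀ {Γ Σ A B} → G Γ (A ∷ []) → G Σ (B ∷ []) → G (Γ ++ Σ) ((A *U B) ∷ [])
  ⇒L    : ∀ {Γ Σ Λ A B} → G Γ (A ∷ []) → G (B ∷ Σ) Λ → G ((A ⇒U B) ∷ (Γ ++ Σ)) Λ
  ⇒R    : ∀ {Γ A B} → G (A ∷ Γ) (B ∷ []) → G Γ ((A ⇒U B) ∷ [])
  cut   : ∀ {Γ Σ Λ} A → G Γ (A ∷ []) → G (A ∷ Σ) Λ → G (Γ ++ Σ) Λ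
  -- additional initial sequents of G (atoms only)
  em    : ∀ p → G [] ((atU p ∨U ¬U p) ∷ [])
  p1    : ∀ p → G (atU p ∷ []) (1U ∷ [])
  np1   : ∀ p → G (¬U p ∷ []) (1U ∷ [])
  z-p    : ∀ p → G (0U ∷ []) (atU p ∷ [])
  z-np   : ∀ p → G (0U ∷ []) (¬U p ∷ [])
  z-00    : G (0U ∷ []) ((0U *U 0U) ∷ [])

sizeG : ∀ {Γ Δ} → G Γ Δ → ℕ
sizeG {Γ} {Δ} (exG _ π) = sizeG π
sizeG {Γ} {Δ} (ax _) = seqSzU Γ Δ
sizeG {Γ} {Δ} ax1 = seqSzU Γ Δ
sizeG {Γ} {Δ} ax0 = seqSzU Γ Δ
sizeG {Γ} {Δ} (L1 π) = seqSzU Γ Δ + sizeG π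
sizeG {Γ} {Δ} (R0 π) = seqSzU Γ Δ + sizeG π
sizeG {Γ} {Δ} (∧L₀ _ π) = seqSzU Γ Δ + sizeG π
sizeG {Γ} {Δ} (∧L₁ _ π) = seqSzU Γ Δ + sizeG π
sizeG {Γ} {Δ} (∧R π ρ) = seqSzU Γ Δ + sizeG π + sizeG ρ
sizeG {Γ} {Δ} (∨L π ρ) = seqSzU Γ Δ + sizeG π + sizeG ρ
sizeG {Γ} {Δ} (∨R₀ _ π) = seqSzU Γ Δ + sizeG π
sizeG {Γ} {Δ} (∨R₁ _ π) = seqSzU Γ Δ + sizeG π
sizeG {Γ} {Δ} (*L π) = seqSzU Γ Δ + sizeG π
sizeG {Γ} {Δ} (*R π ρ) = seqSzU Γ Δ + sizeG π + sizeG ρ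
sizeG {Γ} {Δ} (⇒L π ρ) = seqSzU Γ Δ + sizeG π + sizeG ρ
sizeG {Γ} {Δ} (⇒R π) = seqSzU Γ Δ + sizeG π
sizeG {Γ} {Δ} (cut _ π ρ) = seqSzU Γ Δ + sizeG π + sizeG ρ
sizeG {Γ} {Δ} (em _) = seqSzU Γ Δ
sizeG {Γ} {Δ} (p1 _) = seqSzU Γ Δ
sizeG {Γ} {Δ} (np1 _) = seqSzU Γ Δ
sizeG {Γ} {Δ} (z-p _) = seqSzU Γ Δ
sizeG {Γ} {Δ} (z-np _) = seqSzU Γ Δ
sizeG {Γ} {Δ} z-00 = seqSzU Γ Δ

{-# OPTIONS --safe #-}
module Submission where

open import Defs
open import Data.Bool using (T)
open import Data.Nat using (ℕ; suc; _+_; _*_; _≤_; _^_; _⊔_; z≤n; s≤s; NonZero; _≤ᵇ_; >-nonZero)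
open import Data.Nat.Properties
open import Data.Nat.ListAction using (sum)
open import Data.Nat.ListAction.Properties using (sum-++; sum-↭)
open import Data.Nat.Tactic.RingSolver using (solve-∀)
open import Data.List using (List; []; _∷_; _++_; map; length)
open import Data.List.Properties using (map-++; length-map; ++-assoc; ++-identityʳ)
open import Data.List.Relation.Binary.Permutation.Propositional
  using (_↭_; ↭-refl; ↭-sym; ↭-trans; prep; swap; ↭-reflexive)
open import Data.List.Relation.Binary.Permutation.Propositional.Properties
  using (map⁺; ++⁺; ++⁺ˡ; shift; shifts; ++-comm; ∷↭∷ʳ)
open import Data.List.Relation.Unary.All using (All; []; _∷_; universal)
import Data.List.Relation.Unary.All.Properties as Allₚ
open import Data.Product using (Σ; ∃; _,_)
open import Relation.Binary.PropositionalEquality using (_≡_; refl; sym; trans; cong; cong₂; subst)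

-- An L_p-formula A is read in G through two formulas in negation normal form: A⁺, and the
-- negation normal form A⁻ of ¬A; an LK-sequent Γ ⇒ Δ becomes the one-sided G-sequent Γ⁺, Δ⁻ ⇒.
-- G has neither weakening nor contraction, but for such formulas its atomic axioms give, by
-- induction on A, X ⇒ 1, 0 ⇒ X, A⁺, A⁻ ⇒ and ⇒ A⁺ ∨ A⁻, hence weakening (cut against X ⇒ 1)
-- and contraction (X ⇒ X * X, by cases on X or its dual).  So every LK rule is simulated at a
-- cost polynomial in the size N of the LK-proof, a cut on A becoming a cut on A⁻ ∨ A⁺.
-- Finally, for nnf-formulas toU A and (toP A)⁺ are interderivable, and excluded middle moves
-- the succedent formula back to the right.

infix 30 _⁺ _⁻

mutual
  _⁺ : FmP → FmU
  atP p ⁺ = atU p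
  ⊤P ⁺ = 1U
  ⊥P ⁺ = 0U
  (A ∧P B) ⁺ = A ⁺ ∧U B ⁺
  (A ∨P B) ⁺ = A ⁺ ∨U B ⁺
  (A ⇒P B) ⁺ = A ⁻ ∨U B ⁺

  _⁻ : FmP → FmU
  atP p ⁻ = ¬U p
  ⊤P ⁻ = 0U
  ⊥P ⁻ = 1U
  (A ∧P B) ⁻ = A ⁻ ∨U B ⁻
  (A ∨P B) ⁻ = A ⁻ ∧U B ⁻
  (A ⇒P B) ⁻ = A ⁺ ∧U B ⁻

⟦_⇒_⟧ : List FmP → List FmP → List FmU
⟦ Γ ⇒ Δ ⟧ = map _⁺ Γ ++ map _⁻ Δ

data IsNNF : FmU → Set where
  atU : ∀ p → IsNNF (atU p)
  ¬atU : ∀ p → IsNNF (¬U p)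
  0U : IsNNF 0U
  1U : IsNNF 1U
  _∧U_ : ∀ {X Y} → IsNNF X → IsNNF Y → IsNNF (X ∧U Y)
  _∨U_ : ∀ {X Y} → IsNNF X → IsNNF Y → IsNNF (X ∨U Y)

data Dual : FmU → FmU → Set where
  atU¬U : ∀ p → Dual (atU p) (¬U p)
  ¬UatU : ∀ p → Dual (¬U p) (atU p)
  1U0U : Dual 1U 0U
  0U1U : Dual 0U 1U
  ∧U∨U : ∀ {X X′ Y Y′} → Dual X X′ → Dual Y Y′ → Dual (X ∧U Y) (X′ ∨U Y′)
  ∨U∧U : ∀ {X X′ Y Y′} → Dual X X′ → Dual Y Y′ → Dual (X ∨U Y) (X′ ∧U Y′)

Dual-sym : ∀ {X X′} → Dual X X′ → Dual X′ X
Dual-sym (atU¬U p) = ¬UatU p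
Dual-sym (¬UatU p) = atU¬U p
Dual-sym 1U0U = 0U1U
Dual-sym 0U1U = 1U0U
Dual-sym (∧U∨U d e) = ∨U∧U (Dual-sym d) (Dual-sym e)
Dual-sym (∨U∧U d e) = ∧U∨U (Dual-sym d) (Dual-sym e)

Dual⇒IsNNF : ∀ {X X′} → Dual X X′ → IsNNF X
Dual⇒IsNNF (atU¬U p) = atU p
Dual⇒IsNNF (¬UatU p) = ¬atU p
Dual⇒IsNNF 1U0U = 1U
Dual⇒IsNNF 0U1U = 0U
Dual⇒IsNNF (∧U∨U d e) = Dual⇒IsNNF d ∧U Dual⇒IsNNF e
Dual⇒IsNNF (∨U∧U d e) = Dual⇒IsNNF d ∨U Dual⇒IsNNF e

dual⁺⁻ : ∀ A → Dual (A ⁺) (A ⁻)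
dual⁺⁻ (atP p) = atU¬U p
dual⁺⁻ ⊤P = 1U0U
dual⁺⁻ ⊥P = 0U1U
dual⁺⁻ (A ∧P B) = ∧U∨U (dual⁺⁻ A) (dual⁺⁻ B)
dual⁺⁻ (A ∨P B) = ∨U∧U (dual⁺⁻ A) (dual⁺⁻ B)
dual⁺⁻ (A ⇒P B) = ∨U∧U (Dual-sym (dual⁺⁻ A)) (dual⁺⁻ B)

IsNNF⁺ : ∀ A → IsNNF (A ⁺)
IsNNF⁺ A = Dual⇒IsNNF (dual⁺⁻ A)

IsNNF⁻ : ∀ A → IsNNF (A ⁻)
IsNNF⁻ A = Dual⇒IsNNF (Dual-sym (dual⁺⁻ A))

IsNNF-map⁺ : ∀ Γ → All IsNNF (map _⁺ Γ)
IsNNF-map⁺ Γ = Allₚ.map⁺ (universal IsNNF⁺ Γ)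

IsNNF-⟦⇒⟧ : ∀ Γ Δ → All IsNNF ⟦ Γ ⇒ Δ ⟧
IsNNF-⟦⇒⟧ Γ Δ = Allₚ.++⁺ (IsNNF-map⁺ Γ) (Allₚ.map⁺ (universal IsNNF⁻ Δ))

⁻-to-front : ∀ X Γ Δ → map _⁺ Γ ++ X ∷ map _⁻ Δ ↭ X ∷ ⟦ Γ ⇒ Δ ⟧
⁻-to-front X Γ Δ = shift X (map _⁺ Γ) (map _⁻ Δ)

⟦⇒⟧-++ : ∀ Γ Σ Δ Λ → ⟦ Γ ⇒ Δ ⟧ ++ ⟦ Σ ⇒ Λ ⟧ ↭ ⟦ Γ ++ Σ ⇒ Δ ++ Λ ⟧
⟦⇒⟧-++ Γ Σ Δ Λ = ↭-trans (↭-reflexive (++-assoc (map _⁺ Γ) (map _⁻ Δ) (map _⁺ Σ ++ map _⁻ Λ)))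
  (↭-trans (++⁺ˡ (map _⁺ Γ) (shifts (map _⁻ Δ) (map _⁺ Σ)))
  (↭-trans (↭-reflexive (sym (++-assoc (map _⁺ Γ) (map _⁺ Σ) (map _⁻ Δ ++ map _⁻ Λ))))
  (↭-reflexive (sym (cong₂ _++_ (map-++ _⁺ Γ Σ) (map-++ _⁻ Δ Λ))))))

≤-compute : ∀ {m n} {m≤ᵇn : T (m ≤ᵇ n)} → m ≤ n
≤-compute {m} {n} {m≤ᵇn} = ≤ᵇ⇒≤ m n m≤ᵇn

m+k≡n⇒m≤n : ∀ {m n} k → m + k ≡ n → m ≤ n
m+k≡n⇒m≤n {m} k refl = m≤m+n m k

m+n+o≤p⇒m≤p : ∀ m n {o p} → m + n + o ≤ p → m ≤ p
m+n+o≤p⇒m≤p m n h = m+n≤o⇒m≤o m (m+n≤o⇒m≤o (m + n) h)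

m+n+o≤p⇒n≤p : ∀ m n {o p} → m + n + o ≤ p → n ≤ p
m+n+o≤p⇒n≤p m n h = m+n≤o⇒n≤o m (m+n≤o⇒m≤o (m + n) h)

suc[x+y]≤3*suc[a+b] : ∀ {x y} a b → x ≤ 3 * a → y ≤ 3 * b → suc (x + y) ≤ 3 * suc (a + b)
suc[x+y]≤3*suc[a+b] {x} {y} a b x≤ y≤ = begin
  suc (x + y)             ≤⟨ s≤s (+-mono-≤ x≤ y≤) ⟩
  suc (3 * a + 3 * b)     ≤⟨ m≤n+m _ 2 ⟩
  2 + suc (3 * a + 3 * b) ≡⟨ sizes a b ⟩
  3 * suc (a + b)         ∎
  where
  open ≤-Reasoning
  sizes : ∀ a b → 2 + suc (3 * a + 3 * b) ≡ 3 * suc (a + b)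
  sizes = solve-∀

szUs : List FmU → ℕ
szUs Γ = sum (map szU Γ)

szPs : List FmP → ℕ
szPs Γ = sum (map szP Γ)

szUs-++ : ∀ Γ Σ → szUs (Γ ++ Σ) ≡ szUs Γ + szUs Σ
szUs-++ Γ Σ = trans (cong sum (map-++ szU Γ Σ)) (sum-++ (map szU Γ) (map szU Σ))

szUs-↭ : ∀ {Γ Γ′} → Γ ↭ Γ′ → szUs Γ ≡ szUs Γ′
szUs-↭ p = sum-↭ (map⁺ szU p)

szPs-↭ : ∀ {Γ Γ′} → Γ ↭ Γ′ → szPs Γ ≡ szPs Γ′
szPs-↭ p = sum-↭ (map⁺ szP p)

1≤szU : ∀ X → 1 ≤ szU X
1≤szU (atU _) = s≤s z≤n
1≤szU 0U = s≤s z≤n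
1≤szU 1U = s≤s z≤n
1≤szU (_ ∧U _) = s≤s z≤n
1≤szU (_ ∨U _) = s≤s z≤n
1≤szU (_ *U _) = s≤s z≤n
1≤szU (_ ⇒U _) = s≤s z≤n

1≤szP : ∀ A → 1 ≤ szP A
1≤szP (atP _) = s≤s z≤n
1≤szP ⊤P = s≤s z≤n
1≤szP ⊥P = s≤s z≤n
1≤szP (_ ∧P _) = s≤s z≤n
1≤szP (_ ∨P _) = s≤s z≤n
1≤szP (_ ⇒P _) = s≤s z≤n

length≤szUs : ∀ Γ → length Γ ≤ szUs Γ
length≤szUs [] = z≤n
length≤szUs (X ∷ Γ) = +-mono-≤ (1≤szU X) (length≤szUs Γ)

seqSzU-∷ˡ : ∀ X Γ Δ → seqSzU (X ∷ Γ) Δ ≡ szU X + seqSzU Γ Δ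
seqSzU-∷ˡ X Γ Δ = sizes (szU X) (szUs Γ) (szUs Δ)
  where
  sizes : ∀ x g d → suc (x + g + d) ≡ x + suc (g + d)
  sizes = solve-∀

seqSzU-++ˡ : ∀ Γ Σ Δ → seqSzU (Γ ++ Σ) Δ ≡ szUs Γ + seqSzU Σ Δ
seqSzU-++ˡ Γ Σ Δ = trans (cong (λ x → suc (x + szUs Δ)) (szUs-++ Γ Σ)) (sizes (szUs Γ) (szUs Σ) (szUs Δ))
  where
  sizes : ∀ g s d → suc (g + s + d) ≡ g + suc (s + d)
  sizes = solve-∀

seqSzU-↭ˡ : ∀ {Γ Γ′} Δ → Γ ↭ Γ′ → seqSzU Γ Δ ≡ seqSzU Γ′ Δ
seqSzU-↭ˡ Δ p = cong (λ x → suc (x + szUs Δ)) (szUs-↭ p)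

seqSzP-↭ : ∀ {Γ Γ′ Δ Δ′} → Γ ↭ Γ′ → Δ ↭ Δ′ → seqSzP Γ Δ ≡ seqSzP Γ′ Δ′
seqSzP-↭ p q = cong₂ (λ x y → suc (x + y)) (szPs-↭ p) (szPs-↭ q)

szP≤seqSzPˡ : ∀ A Γ Δ → szP A ≤ seqSzP (A ∷ Γ) Δ
szP≤seqSzPˡ A Γ Δ = ≤-trans (≤-trans (m≤m+n (szP A) (szPs Γ)) (m≤m+n _ (szPs Δ))) (n≤1+n _)

szP≤seqSzPʳ : ∀ Γ A Δ → szP A ≤ seqSzP Γ (A ∷ Δ)
szP≤seqSzPʳ Γ A Δ = ≤-trans (≤-trans (m≤m+n (szP A) (szPs Δ)) (m≤n+m _ (szPs Γ))) (n≤1+n _)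

seqSzP≤seqSzP-∷ˡ : ∀ A Γ Δ → seqSzP Γ Δ ≤ seqSzP (A ∷ Γ) Δ
seqSzP≤seqSzP-∷ˡ A Γ Δ = s≤s (+-monoˡ-≤ (szPs Δ) (m≤n+m (szPs Γ) (szP A)))

seqSzP≤seqSzP-∷ʳ : ∀ Γ A Δ → seqSzP Γ Δ ≤ seqSzP Γ (A ∷ Δ)
seqSzP≤seqSzP-∷ʳ Γ A Δ = s≤s (+-monoʳ-≤ (szPs Γ) (m≤n+m (szPs Δ) (szP A)))

mutual
  szU⁺≤3*szP : ∀ A → szU (A ⁺) ≤ 3 * szP A
  szU⁺≤3*szP (atP p) = s≤s z≤n
  szU⁺≤3*szP ⊤P = s≤s z≤n
  szU⁺≤3*szP ⊥P = s≤s z≤n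
  szU⁺≤3*szP (A ∧P B) = suc[x+y]≤3*suc[a+b] (szP A) (szP B) (szU⁺≤3*szP A) (szU⁺≤3*szP B)
  szU⁺≤3*szP (A ∨P B) = suc[x+y]≤3*suc[a+b] (szP A) (szP B) (szU⁺≤3*szP A) (szU⁺≤3*szP B)
  szU⁺≤3*szP (A ⇒P B) = suc[x+y]≤3*suc[a+b] (szP A) (szP B) (szU⁻≤3*szP A) (szU⁺≤3*szP B)

  szU⁻≤3*szP : ∀ A → szU (A ⁻) ≤ 3 * szP A
  szU⁻≤3*szP (atP p) = ≤-refl
  szU⁻≤3*szP ⊤P = s≤s z≤n
  szU⁻≤3*szP ⊥P = s≤s z≤n
  szU⁻≤3*szP (A ∧P B) = suc[x+y]≤3*suc[a+b] (szP A) (szP B) (szU⁻≤3*szP A) (szU⁻≤3*szP B)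
  szU⁻≤3*szP (A ∨P B) = suc[x+y]≤3*suc[a+b] (szP A) (szP B) (szU⁻≤3*szP A) (szU⁻≤3*szP B)
  szU⁻≤3*szP (A ⇒P B) = suc[x+y]≤3*suc[a+b] (szP A) (szP B) (szU⁺≤3*szP A) (szU⁻≤3*szP B)

szUs-map≤3*szPs : ∀ (f : FmP → FmU) → (∀ A → szU (f A) ≤ 3 * szP A) → ∀ Γ → szUs (map f Γ) ≤ 3 * szPs Γ
szUs-map≤3*szPs f f≤ [] = z≤n
szUs-map≤3*szPs f f≤ (A ∷ Γ) =
  ≤-trans (+-mono-≤ (f≤ A) (szUs-map≤3*szPs f f≤ Γ)) (≤-reflexive (sym (*-distribˡ-+ 3 (szP A) (szPs Γ))))

szUs⟦⇒⟧≤3*szPs : ∀ Γ Δ → szUs ⟦ Γ ⇒ Δ ⟧ ≤ 3 * (szPs Γ + szPs Δ)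
szUs⟦⇒⟧≤3*szPs Γ Δ = begin
  szUs ⟦ Γ ⇒ Δ ⟧                     ≡⟨ szUs-++ (map _⁺ Γ) (map _⁻ Δ) ⟩
  szUs (map _⁺ Γ) + szUs (map _⁻ Δ)  ≤⟨ +-mono-≤ (szUs-map≤3*szPs _⁺ szU⁺≤3*szP Γ)
                                                 (szUs-map≤3*szPs _⁻ szU⁻≤3*szP Δ) ⟩
  3 * szPs Γ + 3 * szPs Δ            ≡⟨ *-distribˡ-+ 3 (szPs Γ) (szPs Δ) ⟨
  3 * (szPs Γ + szPs Δ)              ∎
  where open ≤-Reasoning

szU-toU≤szU-toP⁺ : ∀ A → szU (toU A) ≤ szU (toP A ⁺)
szU-toU≤szU-toP⁺ (pos p) = ≤-refl
szU-toU≤szU-toP⁺ (neg p) = ≤-compute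
szU-toU≤szU-toP⁺ (A ∧N B) = s≤s (+-mono-≤ (szU-toU≤szU-toP⁺ A) (szU-toU≤szU-toP⁺ B))
szU-toU≤szU-toP⁺ (A ∨N B) = s≤s (+-mono-≤ (szU-toU≤szU-toP⁺ A) (szU-toU≤szU-toP⁺ B))

szUs-toU≤szUs-toP⁺ : ∀ Γ → szUs (map toU Γ) ≤ szUs (map _⁺ (map toP Γ))
szUs-toU≤szUs-toP⁺ [] = z≤n
szUs-toU≤szUs-toP⁺ (A ∷ Γ) = +-mono-≤ (szU-toU≤szU-toP⁺ A) (szUs-toU≤szUs-toP⁺ Γ)

seqSzU-toU≤seqSzU-toP⁺ : ∀ Γ R Λ → seqSzU (map toU Γ ++ R) Λ ≤ seqSzU (map _⁺ (map toP Γ) ++ R) Λ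
seqSzU-toU≤seqSzU-toP⁺ Γ R Λ = begin
  seqSzU (map toU Γ ++ R) Λ                ≡⟨ seqSzU-++ˡ (map toU Γ) R Λ ⟩
  szUs (map toU Γ) + seqSzU R Λ            ≤⟨ +-monoˡ-≤ (seqSzU R Λ) (szUs-toU≤szUs-toP⁺ Γ) ⟩
  szUs (map _⁺ (map toP Γ)) + seqSzU R Λ   ≡⟨ seqSzU-++ˡ (map _⁺ (map toP Γ)) R Λ ⟨
  seqSzU (map _⁺ (map toP Γ) ++ R) Λ       ∎
  where open ≤-Reasoning

length≤szUs-toP⁺ : ∀ Γ → length Γ ≤ szUs (map _⁺ (map toP Γ))
length≤szUs-toP⁺ Γ = ≤-trans (≤-reflexive (sym (trans (length-map _⁺ (map toP Γ)) (length-map toP Γ))))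
                             (length≤szUs (map _⁺ (map toP Γ)))

module Simulation (N : ℕ) (2≤N : 2 ≤ N) where

  instance
    N≢0 : NonZero N
    N≢0 = >-nonZero (≤-trans (s≤s z≤n) 2≤N)

  -- Degrees: every size is bounded by a power of N, the size of the LK-proof.  The bound
  -- x ≤ N ^ i is a record so that the exponent i can be read off a proof of it.

  infix 4 _≤ⁿ_
  infixr 6 _⊕_
  record _≤ⁿ_ (x i : ℕ) : Set where
    constructor ⟨_⟩
    field ≤ⁿ⇒≤ : x ≤ N ^ i
  open _≤ⁿ_ public

  N^i≤ⁿi : ∀ i → N ^ i ≤ⁿ i
  N^i≤ⁿi i = ⟨ ≤-refl ⟩

  0≤ⁿ0 : 0 ≤ⁿ 0
  0≤ⁿ0 = ⟨ z≤n ⟩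

  1≤ⁿ0 : 1 ≤ⁿ 0
  1≤ⁿ0 = ⟨ ≤-refl ⟩

  ≤⇒≤ⁿ1 : ∀ {x} → x ≤ N → x ≤ⁿ 1
  ≤⇒≤ⁿ1 {x} p = ⟨ subst (x ≤_) (sym (*-identityʳ N)) p ⟩

  ≤8⇒≤ⁿ3 : ∀ {x} → x ≤ 8 → x ≤ⁿ 3
  ≤8⇒≤ⁿ3 p = ⟨ ≤-trans p (^-monoˡ-≤ 3 2≤N) ⟩

  ≤ⁿ-raise : ∀ {x i j} → i ≤ j → x ≤ⁿ i → x ≤ⁿ j
  ≤ⁿ-raise i≤j ⟨ p ⟩ = ⟨ ≤-trans p (^-monoʳ-≤ N i≤j) ⟩

  ≤-≤ⁿ-trans : ∀ {x y i} → x ≤ y → y ≤ⁿ i → x ≤ⁿ i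
  ≤-≤ⁿ-trans p ⟨ q ⟩ = ⟨ ≤-trans p q ⟩

  ≤ⁿ-operandˡ : ∀ {x y i} → suc (x + y) ≤ⁿ i → x ≤ⁿ i
  ≤ⁿ-operandˡ {x} {y} = ≤-≤ⁿ-trans (≤-trans (m≤m+n x y) (n≤1+n _))

  ≤ⁿ-operandʳ : ∀ {x y i} → suc (x + y) ≤ⁿ i → y ≤ⁿ i
  ≤ⁿ-operandʳ {x} {y} = ≤-≤ⁿ-trans (≤-trans (m≤n+m y x) (n≤1+n _))

  N^i+N^i≤N^1+i : ∀ i → N ^ i + N ^ i ≤ N ^ suc i
  N^i+N^i≤N^1+i i = subst (_≤ N ^ suc i) (cong (N ^ i +_) (+-identityʳ (N ^ i))) (*-monoˡ-≤ (N ^ i) 2≤N)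

  _⊕_ : ∀ {x y i j} → x ≤ⁿ i → y ≤ⁿ j → x + y ≤ⁿ suc (i ⊔ j)
  _⊕_ {i = i} {j} p q = ⟨ ≤-trans (+-mono-≤ (≤ⁿ⇒≤ (≤ⁿ-raise (m≤m⊔n i j) p)) (≤ⁿ⇒≤ (≤ⁿ-raise (m≤n⊔m i j) q)))
                                  (N^i+N^i≤N^1+i (i ⊔ j)) ⟩

  3*≤ⁿ4 : ∀ {x y} → x ≤ 3 * y → y ≤ N → x ≤ⁿ 4
  3*≤ⁿ4 x≤ y≤N = ≤-≤ⁿ-trans x≤ (y≤ⁿ1 ⊕ y≤ⁿ1 ⊕ y≤ⁿ1 ⊕ 0≤ⁿ0)
    where y≤ⁿ1 = ≤⇒≤ⁿ1 y≤N

  szU⁺≤ⁿ4 : ∀ A → szP A ≤ N → szU (A ⁺) ≤ⁿ 4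
  szU⁺≤ⁿ4 A = 3*≤ⁿ4 (szU⁺≤3*szP A)

  szU⁻≤ⁿ4 : ∀ A → szP A ≤ N → szU (A ⁻) ≤ⁿ 4
  szU⁻≤ⁿ4 A = 3*≤ⁿ4 (szU⁻≤3*szP A)

  head⁺≤ⁿ4 : ∀ A Γ Δ → seqSzP (A ∷ Γ) Δ ≤ N → szU (A ⁺) ≤ⁿ 4
  head⁺≤ⁿ4 A Γ Δ h = szU⁺≤ⁿ4 A (≤-trans (szP≤seqSzPˡ A Γ Δ) h)

  head⁻≤ⁿ4 : ∀ Γ A Δ → seqSzP Γ (A ∷ Δ) ≤ N → szU (A ⁻) ≤ⁿ 4
  head⁻≤ⁿ4 Γ A Δ h = szU⁻≤ⁿ4 A (≤-trans (szP≤seqSzPʳ Γ A Δ) h)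

  szUs-map⁺≤ⁿ4 : ∀ Γ Δ → seqSzP Γ Δ ≤ N → szUs (map _⁺ Γ) ≤ⁿ 4
  szUs-map⁺≤ⁿ4 Γ Δ h =
    3*≤ⁿ4 (szUs-map≤3*szPs _⁺ szU⁺≤3*szP Γ) (≤-trans (m≤m+n (szPs Γ) (szPs Δ)) (≤-trans (n≤1+n _) h))

  szUs⟦⇒⟧≤ⁿ4 : ∀ Γ Δ → seqSzP Γ Δ ≤ N → szUs ⟦ Γ ⇒ Δ ⟧ ≤ⁿ 4
  szUs⟦⇒⟧≤ⁿ4 Γ Δ h = 3*≤ⁿ4 (szUs⟦⇒⟧≤3*szPs Γ Δ) (≤-trans (n≤1+n _) h)

  size-unary : ∀ {x y s a X} → x ≤ⁿ s → y ≤ N ^ a + X → x + y ≤ N ^ suc (s ⊔ a) + X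
  size-unary {x} {y} {s} {a} {X} x≤ y≤ = begin
    x + y               ≤⟨ +-monoʳ-≤ x y≤ ⟩
    x + (N ^ a + X)     ≡⟨ +-assoc x (N ^ a) X ⟨
    x + N ^ a + X       ≤⟨ +-monoˡ-≤ X (≤ⁿ⇒≤ (x≤ ⊕ N^i≤ⁿi a)) ⟩
    N ^ suc (s ⊔ a) + X ∎
    where open ≤-Reasoning

  size-binary : ∀ {x y z s a b X Y} → x ≤ⁿ s → y ≤ N ^ a + X → z ≤ N ^ b + Y →
                x + y + z ≤ N ^ suc (suc (s ⊔ a) ⊔ b) + (X + Y)
  size-binary {x} {y} {z} {s} {a} {b} {X} {Y} x≤ y≤ z≤ = begin
    x + y + z                           ≤⟨ +-mono-≤ (size-unary x≤ y≤) z≤ ⟩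
    N ^ suc (s ⊔ a) + X + (N ^ b + Y)   ≡⟨ interchange (N ^ suc (s ⊔ a)) X (N ^ b) Y ⟩
    N ^ suc (s ⊔ a) + N ^ b + (X + Y)   ≤⟨ +-monoˡ-≤ (X + Y) (≤ⁿ⇒≤ (N^i≤ⁿi (suc (s ⊔ a)) ⊕ N^i≤ⁿi b)) ⟩
    N ^ suc (suc (s ⊔ a) ⊔ b) + (X + Y) ∎
    where
    open ≤-Reasoning
    interchange : ∀ p x q y → p + x + (q + y) ≡ p + q + (x + y)
    interchange = solve-∀

  -- The degrees s and a never depend on the formulas involved, while X collects the sizes of
  -- subderivations that are only bounded as a whole, namely the simulated LK-subproofs.
  record Bounded (Γ Δ : List FmU) (s a X : ℕ) : Set where
    constructor bounded
    field
      derivation : G Γ Δ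
      seq≤ⁿ      : seqSzU Γ Δ ≤ⁿ s
      size≤      : sizeG derivation ≤ N ^ a + X
  open Bounded public

  relax : ∀ {Γ Δ s a X s′ a′ X′} → s ≤ s′ → a ≤ a′ → X ≤ X′ → Bounded Γ Δ s a X → Bounded Γ Δ s′ a′ X′
  relax s≤ a≤ X≤ (bounded d q b) = bounded d (≤ⁿ-raise s≤ q) (≤-trans b (+-mono-≤ (^-monoʳ-≤ N a≤) X≤))

  unaryᵇ : ∀ {Γ Δ Γ′ Δ′ s a X s′} (rule : G Γ Δ → G Γ′ Δ′) →
           (∀ d → sizeG (rule d) ≡ seqSzU Γ′ Δ′ + sizeG d) → seqSzU Γ′ Δ′ ≤ⁿ s′ →
           Bounded Γ Δ s a X → Bounded Γ′ Δ′ s′ (suc (s′ ⊔ a)) X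
  unaryᵇ {a = a} {X} rule size-rule q (bounded d _ b) =
    bounded (rule d) q (≤-trans (≤-reflexive (size-rule d)) (size-unary {a = a} {X} q b))

  binaryᵇ : ∀ {Γ₁ Δ₁ Γ₂ Δ₂ Γ′ Δ′ s₁ a₁ X s₂ a₂ Y s′} (rule : G Γ₁ Δ₁ → G Γ₂ Δ₂ → G Γ′ Δ′) →
            (∀ d e → sizeG (rule d e) ≡ seqSzU Γ′ Δ′ + sizeG d + sizeG e) → seqSzU Γ′ Δ′ ≤ⁿ s′ →
            Bounded Γ₁ Δ₁ s₁ a₁ X → Bounded Γ₂ Δ₂ s₂ a₂ Y → Bounded Γ′ Δ′ s′ (suc (suc (s′ ⊔ a₁) ⊔ a₂)) (X + Y)
  binaryᵇ {a₁ = a₁} {X} {a₂ = a₂} {Y} rule size-rule q (bounded d _ b) (bounded e _ c) =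
    bounded (rule d e) q (≤-trans (≤-reflexive (size-rule d e)) (size-binary {a = a₁} {a₂} {X} {Y} q b c))

  initialᵇ : ∀ {Γ Δ} (d : G Γ Δ) → sizeG d ≡ seqSzU Γ Δ → seqSzU Γ Δ ≤ 8 → Bounded Γ Δ 3 3 0
  initialᵇ d size-d q =
    bounded d (≤8⇒≤ⁿ3 q) (≤-trans (≤-reflexive size-d) (≤-trans (≤ⁿ⇒≤ (≤8⇒≤ⁿ3 q)) (m≤m+n _ 0)))

  axᵇ : ∀ {i} A → szU A ≤ⁿ i → let s = suc (suc (i ⊔ i)) in Bounded (A ∷ []) (A ∷ []) s s 0
  axᵇ A h = bounded (ax A) q (≤-trans (≤ⁿ⇒≤ q) (m≤m+n _ 0))
    where
    sizes : ∀ a → suc (a + 0 + (a + 0)) ≡ 1 + (a + a)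
    sizes = solve-∀
    q = ≤-≤ⁿ-trans (≤-reflexive (sizes (szU A))) (1≤ⁿ0 ⊕ h ⊕ h)

  exᵇ : ∀ {Γ Γ′ Δ s a X} → Γ ↭ Γ′ → Bounded Γ Δ s a X → Bounded Γ′ Δ s a X
  exᵇ {Δ = Δ} p (bounded d q b) = bounded (exG p d) (≤-≤ⁿ-trans (≤-reflexive (sym (seqSzU-↭ˡ Δ p))) q) b

  swapᵇ : ∀ {X Y Σ Λ s a Z} → Bounded (X ∷ Y ∷ Σ) Λ s a Z → Bounded (Y ∷ X ∷ Σ) Λ s a Z
  swapᵇ {X} {Y} = exᵇ (swap X Y ↭-refl)

  L1ᵇ : ∀ {Γ Δ s a X} → Bounded Γ Δ s a X → Bounded (1U ∷ Γ) Δ (suc s) (suc (suc s ⊔ a)) X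
  L1ᵇ b = unaryᵇ L1 (λ _ → refl) (1≤ⁿ0 ⊕ seq≤ⁿ b) b

  R0ᵇ : ∀ {Γ s a X} → Bounded Γ [] s a X → Bounded Γ (0U ∷ []) (suc s) (suc (suc s ⊔ a)) X
  R0ᵇ {Γ} b = unaryᵇ R0 (λ _ → refl)
    (≤-≤ⁿ-trans (≤-reflexive (cong suc (+-suc (szUs Γ) 0))) (1≤ⁿ0 ⊕ seq≤ⁿ b)) b

  ∧L₀ᵇ : ∀ {Γ Δ A s a X j} B → szU B ≤ⁿ j → Bounded (A ∷ Γ) Δ s a X →
         let s′ = suc (suc (j ⊔ s)) in Bounded ((A ∧U B) ∷ Γ) Δ s′ (suc (s′ ⊔ a)) X
  ∧L₀ᵇ {Γ} {Δ} {A} B h b = unaryᵇ (∧L₀ B) (λ _ → refl)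
    (≤-≤ⁿ-trans (≤-reflexive (sizes (szU A) (szU B) (szUs Γ) (szUs Δ))) (1≤ⁿ0 ⊕ h ⊕ seq≤ⁿ b)) b
    where
    sizes : ∀ a b g d → suc (suc (a + b) + g + d) ≡ 1 + (b + suc (a + g + d))
    sizes = solve-∀

  ∧L₁ᵇ : ∀ {Γ Δ B s a X j} A → szU A ≤ⁿ j → Bounded (B ∷ Γ) Δ s a X →
         let s′ = suc (suc (j ⊔ s)) in Bounded ((A ∧U B) ∷ Γ) Δ s′ (suc (s′ ⊔ a)) X
  ∧L₁ᵇ {Γ} {Δ} {B} A h b = unaryᵇ (∧L₁ A) (λ _ → refl)
    (≤-≤ⁿ-trans (≤-reflexive (sizes (szU A) (szU B) (szUs Γ) (szUs Δ))) (1≤ⁿ0 ⊕ h ⊕ seq≤ⁿ b)) b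
    where
    sizes : ∀ a b g d → suc (suc (a + b) + g + d) ≡ 1 + (a + suc (b + g + d))
    sizes = solve-∀

  ∨R₀ᵇ : ∀ {Γ A s a X j} B → szU B ≤ⁿ j → Bounded Γ (A ∷ []) s a X →
         let s′ = suc (suc (j ⊔ s)) in Bounded Γ ((A ∨U B) ∷ []) s′ (suc (s′ ⊔ a)) X
  ∨R₀ᵇ {Γ} {A} B h b = unaryᵇ (∨R₀ B) (λ _ → refl)
    (≤-≤ⁿ-trans (≤-reflexive (sizes (szU A) (szU B) (szUs Γ))) (1≤ⁿ0 ⊕ h ⊕ seq≤ⁿ b)) b
    where
    sizes : ∀ a b g → suc (g + (suc (a + b) + 0)) ≡ 1 + (b + suc (g + (a + 0)))
    sizes = solve-∀

  ∨R₁ᵇ : ∀ {Γ B s a X j} A → szU A ≤ⁿ j → Bounded Γ (B ∷ []) s a X →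
         let s′ = suc (suc (j ⊔ s)) in Bounded Γ ((A ∨U B) ∷ []) s′ (suc (s′ ⊔ a)) X
  ∨R₁ᵇ {Γ} {B} A h b = unaryᵇ (∨R₁ A) (λ _ → refl)
    (≤-≤ⁿ-trans (≤-reflexive (sizes (szU A) (szU B) (szUs Γ))) (1≤ⁿ0 ⊕ h ⊕ seq≤ⁿ b)) b
    where
    sizes : ∀ a b g → suc (g + (suc (a + b) + 0)) ≡ 1 + (a + suc (g + (b + 0)))
    sizes = solve-∀

  *Lᵇ : ∀ {Γ Δ A B s a X} → Bounded (A ∷ B ∷ Γ) Δ s a X → Bounded ((A *U B) ∷ Γ) Δ (suc s) (suc (suc s ⊔ a)) X
  *Lᵇ {Γ} {Δ} {A} {B} b = unaryᵇ *L (λ _ → refl)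
    (≤-≤ⁿ-trans (≤-reflexive (sizes (szU A) (szU B) (szUs Γ) (szUs Δ))) (1≤ⁿ0 ⊕ seq≤ⁿ b)) b
    where
    sizes : ∀ a b g d → suc (suc (a + b) + g + d) ≡ 1 + suc (a + (b + g) + d)
    sizes = solve-∀

  ∧Rᵇ : ∀ {Γ A B s₁ a₁ X s₂ a₂ Y} → Bounded Γ (A ∷ []) s₁ a₁ X → Bounded Γ (B ∷ []) s₂ a₂ Y →
        let s′ = suc (s₁ ⊔ s₂) in Bounded Γ ((A ∧U B) ∷ []) s′ (suc (suc (s′ ⊔ a₁) ⊔ a₂)) (X + Y)
  ∧Rᵇ {Γ} {A} {B} b c = binaryᵇ ∧R (λ _ _ → refl)
    (≤-≤ⁿ-trans (m+k≡n⇒m≤n (szUs Γ) (sizes (szU A) (szU B) (szUs Γ))) (seq≤ⁿ b ⊕ seq≤ⁿ c)) b c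
    where
    sizes : ∀ a b g → suc (g + (suc (a + b) + 0)) + g ≡ suc (g + (a + 0)) + suc (g + (b + 0))
    sizes = solve-∀

  ∨Lᵇ : ∀ {Γ Δ A B s₁ a₁ X s₂ a₂ Y} → Bounded (A ∷ Γ) Δ s₁ a₁ X → Bounded (B ∷ Γ) Δ s₂ a₂ Y →
        let s′ = suc (s₁ ⊔ s₂) in Bounded ((A ∨U B) ∷ Γ) Δ s′ (suc (suc (s′ ⊔ a₁) ⊔ a₂)) (X + Y)
  ∨Lᵇ {Γ} {Δ} {A} {B} b c = binaryᵇ ∨L (λ _ _ → refl)
    (≤-≤ⁿ-trans (m+k≡n⇒m≤n (szUs Γ + szUs Δ) (sizes (szU A) (szU B) (szUs Γ) (szUs Δ)))
                (seq≤ⁿ b ⊕ seq≤ⁿ c)) b c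
    where
    sizes : ∀ a b g d → suc (suc (a + b) + g + d) + (g + d) ≡ suc (a + g + d) + suc (b + g + d)
    sizes = solve-∀

  *Rᵇ : ∀ {Γ Σ A B s₁ a₁ X s₂ a₂ Y} → Bounded Γ (A ∷ []) s₁ a₁ X → Bounded Σ (B ∷ []) s₂ a₂ Y →
        let s′ = suc (s₁ ⊔ s₂) in Bounded (Γ ++ Σ) ((A *U B) ∷ []) s′ (suc (suc (s′ ⊔ a₁) ⊔ a₂)) (X + Y)
  *Rᵇ {Γ} {Σ} {A} {B} b c = binaryᵇ *R (λ _ _ → refl)
    (≤-≤ⁿ-trans (≤-reflexive (trans (seqSzU-++ˡ Γ Σ ((A *U B) ∷ [])) (sizes (szU A) (szU B) (szUs Γ) (szUs Σ))))
                (seq≤ⁿ b ⊕ seq≤ⁿ c)) b c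
    where
    sizes : ∀ a b g s → g + suc (s + (suc (a + b) + 0)) ≡ suc (g + (a + 0)) + suc (s + (b + 0))
    sizes = solve-∀

  ⇒Lᵇ : ∀ {Γ Σ Λ A B s₁ a₁ X s₂ a₂ Y} → Bounded Γ (A ∷ []) s₁ a₁ X → Bounded (B ∷ Σ) Λ s₂ a₂ Y →
        let s′ = suc (s₁ ⊔ s₂) in Bounded ((A ⇒U B) ∷ (Γ ++ Σ)) Λ s′ (suc (suc (s′ ⊔ a₁) ⊔ a₂)) (X + Y)
  ⇒Lᵇ {Γ} {Σ} {Λ} {A} {B} b c = binaryᵇ ⇒L (λ _ _ → refl)
    (≤-≤ⁿ-trans (≤-reflexive (trans (seqSzU-∷ˡ (A ⇒U B) (Γ ++ Σ) Λ)
                                    (cong (szU (A ⇒U B) +_) (seqSzU-++ˡ Γ Σ Λ))))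
      (≤-≤ⁿ-trans (≤-reflexive (sizes (szU A) (szU B) (szUs Γ) (szUs Σ) (szUs Λ))) (seq≤ⁿ b ⊕ seq≤ⁿ c))) b c
    where
    sizes : ∀ a b g s l → suc (a + b) + (g + suc (s + l)) ≡ suc (g + (a + 0)) + suc (b + s + l)
    sizes = solve-∀

  cutᵇ : ∀ {Γ Σ Λ s₁ a₁ X s₂ a₂ Y} A → Bounded Γ (A ∷ []) s₁ a₁ X → Bounded (A ∷ Σ) Λ s₂ a₂ Y →
         let s′ = suc (s₁ ⊔ s₂) in Bounded (Γ ++ Σ) Λ s′ (suc (suc (s′ ⊔ a₁) ⊔ a₂)) (X + Y)
  cutᵇ {Γ} {Σ} {Λ} A b c = binaryᵇ (cut A) (λ _ _ → refl)
    (≤-≤ⁿ-trans (m+k≡n⇒m≤n (suc (szU A + szU A))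
                  (trans (cong (_+ suc (szU A + szU A)) (seqSzU-++ˡ Γ Σ Λ))
                         (sizes (szU A) (szUs Γ) (szUs Σ) (szUs Λ))))
                (seq≤ⁿ b ⊕ seq≤ⁿ c)) b c
    where
    sizes : ∀ a g s l → g + suc (s + l) + suc (a + a) ≡ suc (g + (a + 0)) + suc (a + s + l)
    sizes = solve-∀

  seq[_⇒_]≤ⁿ : ∀ X Y {i j} → szU X ≤ⁿ i → szU Y ≤ⁿ j → seqSzU (X ∷ []) (Y ∷ []) ≤ⁿ suc (suc (i ⊔ j))
  seq[ X ⇒ Y ]≤ⁿ hX hY = ≤-≤ⁿ-trans (≤-reflexive (sizes (szU X) (szU Y))) (1≤ⁿ0 ⊕ hX ⊕ hY)
    where
    sizes : ∀ x y → suc (x + 0 + (y + 0)) ≡ 1 + (x + y)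
    sizes = solve-∀

  seq[_,_⇒]≤ⁿ : ∀ X Y {i j} → szU X ≤ⁿ i → szU Y ≤ⁿ j → seqSzU (X ∷ Y ∷ []) [] ≤ⁿ suc (suc (i ⊔ j))
  seq[ X , Y ⇒]≤ⁿ hX hY = ≤-≤ⁿ-trans (≤-reflexive (sizes (szU X) (szU Y))) (1≤ⁿ0 ⊕ hX ⊕ hY)
    where
    sizes : ∀ x y → suc (x + (y + 0) + 0) ≡ 1 + (x + y)
    sizes = solve-∀

  seq[⇒_]≤ⁿ : ∀ X {i} → szU X ≤ⁿ i → seqSzU [] (X ∷ []) ≤ⁿ suc i
  seq[⇒ X ]≤ⁿ hX = ≤-≤ⁿ-trans (≤-reflexive (cong suc (+-identityʳ (szU X)))) (1≤ⁿ0 ⊕ hX)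

  -- In a recursion on a formula the degrees would grow with its depth, so each step is closed
  -- to degree 0 at the price of a summand w * N ^ k, with w the size of the formula; in the
  -- end w ≤ N ^ j is absorbed into the degree.
  close : ∀ {Γ Δ s a X s′ k} w → a ≤ k → seqSzU Γ Δ ≤ⁿ s′ → X ≤ w * N ^ k →
          Bounded Γ Δ s a X → Bounded Γ Δ s′ 0 (suc w * N ^ k)
  close {a = a} {X} {k = k} w a≤k q X≤ (bounded d _ b) = bounded d q (begin
    sizeG d               ≤⟨ b ⟩
    N ^ a + X             ≤⟨ +-mono-≤ (^-monoʳ-≤ N a≤k) X≤ ⟩
    N ^ k + w * N ^ k     ≤⟨ m≤n+m _ (N ^ 0) ⟩
    N ^ 0 + suc w * N ^ k ∎)
    where open ≤-Reasoning

  close₁ : ∀ {Γ Δ s a s′ k} x y → a ≤ k → seqSzU Γ Δ ≤ⁿ s′ →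
           Bounded Γ Δ s a (x * N ^ k) → Bounded Γ Δ s′ 0 (suc (x + y) * N ^ k)
  close₁ {k = k} x y a≤k q = close (x + y) a≤k q (*-monoˡ-≤ (N ^ k) (m≤m+n x y))

  close₂ : ∀ {Γ Δ s a s′ k} x y → a ≤ k → seqSzU Γ Δ ≤ⁿ s′ →
           Bounded Γ Δ s a (x * N ^ k + y * N ^ k) → Bounded Γ Δ s′ 0 (suc (x + y) * N ^ k)
  close₂ {k = k} x y a≤k q = close (x + y) a≤k q (≤-reflexive (sym (*-distribʳ-+ (N ^ k) x y)))

  localize : ∀ {Γ Δ s w j k} → w ≤ⁿ j → Bounded Γ Δ s 0 (w * N ^ k) → Bounded Γ Δ s (suc (j + k)) 0
  localize {w = w} {j} {k} w≤ (bounded d q b) =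
    bounded d q (≤-trans b (≤-trans (≤ⁿ⇒≤ (1≤ⁿ0 ⊕ w*N^k≤ⁿ)) (m≤m+n _ 0)))
    where
    w*N^k≤ⁿ : w * N ^ k ≤ⁿ j + k
    w*N^k≤ⁿ = ⟨ ≤-trans (*-monoˡ-≤ (N ^ k) (≤ⁿ⇒≤ w≤)) (≤-reflexive (sym (^-distribˡ-+-* N j k))) ⟩

  -- Structural rules for formulas in negation normal form

  -- 0 ⇒ 1 is not derivable in FLe; G derives it through an atom, 0 ⇒ p ⇒ 1.
  0⇒1 : Bounded (0U ∷ []) (1U ∷ []) 4 6 0
  0⇒1 = cutᵇ (atU 0) (initialᵇ (z-p 0) refl ≤-compute) (initialᵇ (p1 0) refl ≤-compute)

  weakening-linear : ∀ {X} → IsNNF X → szU X ≤ⁿ 4 → Bounded (X ∷ []) (1U ∷ []) 6 0 (szU X * N ^ 20)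
  weakening-linear (atU p) h =
    close {k = 20} 0 ≤-compute (seq[ atU p ⇒ 1U ]≤ⁿ h 1≤ⁿ0) z≤n (initialᵇ (p1 p) refl ≤-compute)
  weakening-linear (¬atU p) h =
    close {k = 20} 2 ≤-compute (seq[ ¬U p ⇒ 1U ]≤ⁿ h 1≤ⁿ0) z≤n (initialᵇ (np1 p) refl ≤-compute)
  weakening-linear 0U h = close {k = 20} 0 ≤-compute (seq[ 0U ⇒ 1U ]≤ⁿ h 1≤ⁿ0) z≤n 0⇒1
  weakening-linear 1U h = close {k = 20} 0 ≤-compute (seq[ 1U ⇒ 1U ]≤ⁿ h 1≤ⁿ0) z≤n (axᵇ 1U 1≤ⁿ0)
  weakening-linear (_∧U_ {X} {Y} nX nY) h =
    close₁ {k = 20} (szU X) (szU Y) ≤-compute (seq[ X ∧U Y ⇒ 1U ]≤ⁿ h 1≤ⁿ0)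
      (∧L₀ᵇ Y (≤ⁿ-operandʳ h) (weakening-linear nX (≤ⁿ-operandˡ h)))
  weakening-linear (_∨U_ {X} {Y} nX nY) h =
    close₂ {k = 20} (szU X) (szU Y) ≤-compute (seq[ X ∨U Y ⇒ 1U ]≤ⁿ h 1≤ⁿ0)
      (∨Lᵇ (weakening-linear nX (≤ⁿ-operandˡ h)) (weakening-linear nY (≤ⁿ-operandʳ h)))

  weakening : ∀ {X} → IsNNF X → szU X ≤ⁿ 4 → Bounded (X ∷ []) (1U ∷ []) 6 25 0
  weakening n h = localize h (weakening-linear n h)

  exFalso-linear : ∀ {X} → IsNNF X → szU X ≤ⁿ 4 → Bounded (0U ∷ []) (X ∷ []) 6 0 (szU X * N ^ 20)
  exFalso-linear (atU p) h =
    close {k = 20} 0 ≤-compute (seq[ 0U ⇒ atU p ]≤ⁿ 1≤ⁿ0 h) z≤n (initialᵇ (z-p p) refl ≤-compute)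
  exFalso-linear (¬atU p) h =
    close {k = 20} 2 ≤-compute (seq[ 0U ⇒ ¬U p ]≤ⁿ 1≤ⁿ0 h) z≤n (initialᵇ (z-np p) refl ≤-compute)
  exFalso-linear 0U h = close {k = 20} 0 ≤-compute (seq[ 0U ⇒ 0U ]≤ⁿ 1≤ⁿ0 h) z≤n (axᵇ 0U 1≤ⁿ0)
  exFalso-linear 1U h = close {k = 20} 0 ≤-compute (seq[ 0U ⇒ 1U ]≤ⁿ 1≤ⁿ0 h) z≤n 0⇒1
  exFalso-linear (_∧U_ {X} {Y} nX nY) h =
    close₂ {k = 20} (szU X) (szU Y) ≤-compute (seq[ 0U ⇒ X ∧U Y ]≤ⁿ 1≤ⁿ0 h)
      (∧Rᵇ (exFalso-linear nX (≤ⁿ-operandˡ h)) (exFalso-linear nY (≤ⁿ-operandʳ h)))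
  exFalso-linear (_∨U_ {X} {Y} nX nY) h =
    close₁ {k = 20} (szU X) (szU Y) ≤-compute (seq[ 0U ⇒ X ∨U Y ]≤ⁿ 1≤ⁿ0 h)
      (∨R₀ᵇ Y (≤ⁿ-operandʳ h) (exFalso-linear nX (≤ⁿ-operandˡ h)))

  exFalso : ∀ {X} → IsNNF X → szU X ≤ⁿ 4 → Bounded (0U ∷ []) (X ∷ []) 6 25 0
  exFalso n h = localize h (exFalso-linear n h)

  contradiction-linear : ∀ {X X′} → Dual X X′ → szU X ≤ⁿ 4 → szU X′ ≤ⁿ 4 →
                         Bounded (X ∷ X′ ∷ []) [] 6 0 (szU X * N ^ 20)
  contradiction-linear (atU¬U p) h h′ = close {k = 20} 0 ≤-compute (seq[ atU p , ¬U p ⇒]≤ⁿ h h′) z≤n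
    (swapᵇ (⇒Lᵇ (axᵇ (atU p) h) (initialᵇ ax0 refl ≤-compute)))
  contradiction-linear (¬UatU p) h h′ = close {k = 20} 2 ≤-compute (seq[ ¬U p , atU p ⇒]≤ⁿ h h′) z≤n
    (⇒Lᵇ (axᵇ (atU p) h′) (initialᵇ ax0 refl ≤-compute))
  contradiction-linear 1U0U h h′ = close {k = 20} 0 ≤-compute (seq[ 1U , 0U ⇒]≤ⁿ h h′) z≤n
    (L1ᵇ (initialᵇ ax0 refl ≤-compute))
  contradiction-linear 0U1U h h′ = close {k = 20} 0 ≤-compute (seq[ 0U , 1U ⇒]≤ⁿ h h′) z≤n
    (swapᵇ (L1ᵇ (initialᵇ ax0 refl ≤-compute)))
  contradiction-linear (∧U∨U {X} {X′} {Y} {Y′} d e) h h′ =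
    close₂ {k = 20} (szU X) (szU Y) ≤-compute (seq[ X ∧U Y , X′ ∨U Y′ ⇒]≤ⁿ h h′)
      (swapᵇ (∨Lᵇ (swapᵇ (∧L₀ᵇ Y hY (contradiction-linear d hX hX′)))
                  (swapᵇ (∧L₁ᵇ X hX (contradiction-linear e hY hY′)))))
    where
    hX = ≤ⁿ-operandˡ h
    hY = ≤ⁿ-operandʳ h
    hX′ = ≤ⁿ-operandˡ h′
    hY′ = ≤ⁿ-operandʳ h′
  contradiction-linear (∨U∧U {X} {X′} {Y} {Y′} d e) h h′ =
    close₂ {k = 20} (szU X) (szU Y) ≤-compute (seq[ X ∨U Y , X′ ∧U Y′ ⇒]≤ⁿ h h′)
      (∨Lᵇ (swapᵇ (∧L₀ᵇ Y′ hY′ (swapᵇ (contradiction-linear d hX hX′))))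
           (swapᵇ (∧L₁ᵇ X′ hX′ (swapᵇ (contradiction-linear e hY hY′)))))
    where
    hX = ≤ⁿ-operandˡ h
    hY = ≤ⁿ-operandʳ h
    hX′ = ≤ⁿ-operandˡ h′
    hY′ = ≤ⁿ-operandʳ h′

  contradiction : ∀ {X X′} → Dual X X′ → szU X ≤ⁿ 4 → szU X′ ≤ⁿ 4 → Bounded (X ∷ X′ ∷ []) [] 6 25 0
  contradiction d h h′ = localize h (contradiction-linear d h h′)

  excludedMiddle-∨∧ : ∀ {X X′ Y Y′ Z₁ Z₂} → szU X ≤ⁿ 4 → szU X′ ≤ⁿ 4 → szU Y ≤ⁿ 4 → szU Y′ ≤ⁿ 4 →
                      Bounded (X′ ∷ []) (1U ∷ []) 6 25 0 → Bounded (Y′ ∷ []) (1U ∷ []) 6 25 0 →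
                      Bounded [] ((X ∨U X′) ∷ []) 7 0 Z₁ → Bounded [] ((Y ∨U Y′) ∷ []) 7 0 Z₂ →
                      Bounded [] (((X ∨U Y) ∨U (X′ ∧U Y′)) ∷ []) 16 36 (Z₁ + Z₂)
  excludedMiddle-∨∧ {X} {X′} {Y} {Y′} {Z₁} {Z₂} hX hX′ hY hY′ wX′ wY′ emX emY =
    relax ≤-compute ≤-compute (≤-reflexive (cong (Z₁ +_) (+-identityʳ Z₂)))
      (cutᵇ (X ∨U X′) emX (∨Lᵇ caseX caseX′))
    where
    caseX = ∨R₀ᵇ (X′ ∧U Y′) (1≤ⁿ0 ⊕ hX′ ⊕ hY′) (∨R₀ᵇ Y hY (axᵇ X hX))
    caseY = swapᵇ (cutᵇ 1U wX′ (L1ᵇ (∨R₀ᵇ (X′ ∧U Y′) (1≤ⁿ0 ⊕ hX′ ⊕ hY′) (∨R₁ᵇ X hX (axᵇ Y hY)))))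
    caseY′ = ∨R₁ᵇ (X ∨U Y) (1≤ⁿ0 ⊕ hX ⊕ hY)
               (∧Rᵇ (cutᵇ 1U wY′ (L1ᵇ (axᵇ X′ hX′))) (swapᵇ (cutᵇ 1U wX′ (L1ᵇ (axᵇ Y′ hY′)))))
    caseX′ = cutᵇ (Y ∨U Y′) emY (∨Lᵇ caseY caseY′)

  excludedMiddle-∧∨ : ∀ {X X′ Y Y′ Z₁ Z₂} → szU X ≤ⁿ 4 → szU X′ ≤ⁿ 4 → szU Y ≤ⁿ 4 → szU Y′ ≤ⁿ 4 →
                      Bounded (X ∷ []) (1U ∷ []) 6 25 0 → Bounded (Y ∷ []) (1U ∷ []) 6 25 0 →
                      Bounded [] ((X ∨U X′) ∷ []) 7 0 Z₁ → Bounded [] ((Y ∨U Y′) ∷ []) 7 0 Z₂ →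
                      Bounded [] (((X ∧U Y) ∨U (X′ ∨U Y′)) ∷ []) 16 36 (Z₁ + Z₂)
  excludedMiddle-∧∨ {X} {X′} {Y} {Y′} {Z₁} {Z₂} hX hX′ hY hY′ wX wY emX emY =
    relax ≤-compute ≤-compute (≤-reflexive (cong (Z₁ +_) (trans (+-identityʳ _) (+-identityʳ Z₂))))
      (cutᵇ (X ∨U X′) emX (∨Lᵇ caseX caseX′))
    where
    caseX′ = ∨R₁ᵇ (X ∧U Y) (1≤ⁿ0 ⊕ hX ⊕ hY) (∨R₀ᵇ Y′ hY′ (axᵇ X′ hX′))
    caseY = ∨R₀ᵇ (X′ ∨U Y′) (1≤ⁿ0 ⊕ hX′ ⊕ hY′)
              (∧Rᵇ (cutᵇ 1U wY (L1ᵇ (axᵇ X hX))) (swapᵇ (cutᵇ 1U wX (L1ᵇ (axᵇ Y hY)))))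
    caseY′ = swapᵇ (cutᵇ 1U wX (L1ᵇ (∨R₁ᵇ (X ∧U Y) (1≤ⁿ0 ⊕ hX ⊕ hY) (∨R₁ᵇ X′ hX′ (axᵇ Y′ hY′)))))
    caseX = cutᵇ (Y ∨U Y′) emY (∨Lᵇ caseY caseY′)

  excludedMiddle-linear : ∀ {X X′} → Dual X X′ → szU X ≤ⁿ 4 → szU X′ ≤ⁿ 4 →
                          Bounded [] ((X ∨U X′) ∷ []) 7 0 (szU X * N ^ 40)
  excludedMiddle-linear (atU¬U p) h h′ =
    close {k = 40} 0 ≤-compute (seq[⇒ atU p ∨U ¬U p ]≤ⁿ (1≤ⁿ0 ⊕ h ⊕ h′)) z≤n (initialᵇ (em p) refl ≤-compute)
  excludedMiddle-linear (¬UatU p) h h′ =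
    close {k = 40} 2 ≤-compute (seq[⇒ ¬U p ∨U atU p ]≤ⁿ (1≤ⁿ0 ⊕ h ⊕ h′)) z≤n
      (cutᵇ (atU p ∨U ¬U p) (initialᵇ (em p) refl ≤-compute)
        (∨Lᵇ (∨R₁ᵇ (¬U p) h (axᵇ (atU p) h′)) (∨R₀ᵇ (atU p) h′ (axᵇ (¬U p) h))))
  excludedMiddle-linear 1U0U h h′ =
    close {k = 40} 0 ≤-compute (seq[⇒ 1U ∨U 0U ]≤ⁿ (1≤ⁿ0 ⊕ h ⊕ h′)) z≤n (∨R₀ᵇ 0U h′ (initialᵇ ax1 refl ≤-compute))
  excludedMiddle-linear 0U1U h h′ =
    close {k = 40} 0 ≤-compute (seq[⇒ 0U ∨U 1U ]≤ⁿ (1≤ⁿ0 ⊕ h ⊕ h′)) z≤n (∨R₁ᵇ 0U h (initialᵇ ax1 refl ≤-compute))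
  excludedMiddle-linear (∨U∧U {X} {X′} {Y} {Y′} d e) h h′ =
    close₂ {k = 40} (szU X) (szU Y) ≤-compute (seq[⇒ (X ∨U Y) ∨U (X′ ∧U Y′) ]≤ⁿ (1≤ⁿ0 ⊕ h ⊕ h′))
      (excludedMiddle-∨∧ hX hX′ hY hY′
        (weakening (Dual⇒IsNNF (Dual-sym d)) hX′) (weakening (Dual⇒IsNNF (Dual-sym e)) hY′)
        (excludedMiddle-linear d hX hX′) (excludedMiddle-linear e hY hY′))
    where
    hX = ≤ⁿ-operandˡ h
    hY = ≤ⁿ-operandʳ h
    hX′ = ≤ⁿ-operandˡ h′
    hY′ = ≤ⁿ-operandʳ h′
  excludedMiddle-linear (∧U∨U {X} {X′} {Y} {Y′} d e) h h′ =
    close₂ {k = 40} (szU X) (szU Y) ≤-compute (seq[⇒ (X ∧U Y) ∨U (X′ ∨U Y′) ]≤ⁿ (1≤ⁿ0 ⊕ h ⊕ h′))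
      (excludedMiddle-∧∨ hX hX′ hY hY′
        (weakening (Dual⇒IsNNF d) hX) (weakening (Dual⇒IsNNF e) hY)
        (excludedMiddle-linear d hX hX′) (excludedMiddle-linear e hY hY′))
    where
    hX = ≤ⁿ-operandˡ h
    hY = ≤ⁿ-operandʳ h
    hX′ = ≤ⁿ-operandˡ h′
    hY′ = ≤ⁿ-operandʳ h′

  excludedMiddle : ∀ {X X′} → Dual X X′ → szU X ≤ⁿ 4 → szU X′ ≤ⁿ 4 → Bounded [] ((X ∨U X′) ∷ []) 7 45 0
  excludedMiddle d h h′ = localize h (excludedMiddle-linear d h h′)

  contraction : ∀ {X X′} → Dual X X′ → szU X ≤ⁿ 4 → szU X′ ≤ⁿ 4 → Bounded (X ∷ []) ((X *U X) ∷ []) 12 47 0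
  contraction {X} {X′} d h h′ =
    cutᵇ (X ∨U X′) (excludedMiddle d h h′)
      (∨Lᵇ (*Rᵇ (axᵇ X h) (axᵇ X h)) (cutᵇ 0U (R0ᵇ (swapᵇ (contradiction d h h′))) 0⇒X*X))
    where
    0⇒X = exFalso (Dual⇒IsNNF d) h
    0⇒X*X = cutᵇ (0U *U 0U) (initialᵇ z-00 refl ≤-compute) (*Lᵇ (*Rᵇ 0⇒X 0⇒X))

  weakenAll : ∀ {Σ Λ} W → All IsNNF W → szUs W ≤ⁿ 4 → G Σ Λ → G (W ++ Σ) Λ
  weakenAll [] [] _ d = d
  weakenAll (X ∷ W) (nX ∷ nW) h d =
    cut 1U (derivation (weakening nX (≤-≤ⁿ-trans (m≤m+n (szU X) (szUs W)) h)))
      (L1 (weakenAll W nW (≤-≤ⁿ-trans (m≤n+m (szUs W) (szU X)) h) d))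

  size-weakenAll : ∀ {Σ Λ} t W (nW : All IsNNF W) (h : szUs W ≤ⁿ 4) (d : G Σ Λ) →
                   seqSzU (W ++ Σ) Λ ≤ N ^ t →
                   sizeG (weakenAll W nW h d) ≤ length W * (N ^ t + (N ^ 25 + 0) + N ^ t) + sizeG d
  size-weakenAll t [] [] h d q = ≤-refl
  size-weakenAll {Σ} {Λ} t (X ∷ W) (nX ∷ nW) h d q = begin
    seqSzU (X ∷ W ++ Σ) Λ + sizeG w + (seqSzU (1U ∷ W ++ Σ) Λ + sizeG (weakenAll W nW hW d))
      ≤⟨ +-mono-≤ (+-mono-≤ q (size≤ (weakening nX hX))) (+-mono-≤ q₁ (size-weakenAll t W nW hW d q₀)) ⟩
    N ^ t + (N ^ 25 + 0) + (N ^ t + (length W * C + sizeG d))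
      ≡⟨ sizes (N ^ t) (N ^ 25 + 0) (length W) (sizeG d) ⟩
    length (X ∷ W) * C + sizeG d ∎
    where
    open ≤-Reasoning
    C = N ^ t + (N ^ 25 + 0) + N ^ t
    hX = ≤-≤ⁿ-trans (m≤m+n (szU X) (szUs W)) h
    hW = ≤-≤ⁿ-trans (m≤n+m (szUs W) (szU X)) h
    w = derivation (weakening nX hX)
    q₀ : seqSzU (W ++ Σ) Λ ≤ N ^ t
    q₀ = ≤-trans (≤-trans (m≤n+m _ (szU X)) (≤-reflexive (sym (seqSzU-∷ˡ X (W ++ Σ) Λ)))) q
    q₁ : seqSzU (1U ∷ W ++ Σ) Λ ≤ N ^ t
    q₁ = ≤-trans (≤-trans (+-monoˡ-≤ (seqSzU (W ++ Σ) Λ) (1≤szU X)) (≤-reflexive (sym (seqSzU-∷ˡ X (W ++ Σ) Λ)))) q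
    sizes : ∀ n o l g → n + o + (n + (l * (n + o + n) + g)) ≡ suc l * (n + o + n) + g
    sizes = solve-∀

  weakenᶜ : ∀ {Σ Λ s a Y} W → All IsNNF W → szUs W ≤ⁿ 4 → s ≤ 6 → Bounded Σ Λ s a Y →
            Bounded (W ++ Σ) Λ 7 (suc (31 ⊔ a)) Y
  weakenᶜ {Σ} {Λ} {a = a} {Y} W nW h s≤6 (bounded d q b) =
    bounded (weakenAll W nW h d) q′
      (≤-trans (size-weakenAll 7 W nW h d (≤ⁿ⇒≤ q′)) (size-unary {a = a} {Y} cost b))
    where
    q′ : seqSzU (W ++ Σ) Λ ≤ⁿ 7
    q′ = ≤-≤ⁿ-trans (≤-reflexive (seqSzU-++ˡ W Σ Λ)) (h ⊕ ≤ⁿ-raise s≤6 q)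
    C≤ⁿ27 : N ^ 7 + (N ^ 25 + 0) + N ^ 7 ≤ⁿ 27
    C≤ⁿ27 = (N^i≤ⁿi 7 ⊕ ≤-≤ⁿ-trans (≤-reflexive (+-identityʳ _)) (N^i≤ⁿi 25)) ⊕ N^i≤ⁿi 7
    cost : length W * (N ^ 7 + (N ^ 25 + 0) + N ^ 7) ≤ⁿ 31
    cost = ⟨ ≤-trans (*-mono-≤ (≤ⁿ⇒≤ (≤-≤ⁿ-trans (length≤szUs W) h)) (≤ⁿ⇒≤ C≤ⁿ27))
                     (≤-reflexive (sym (^-distribˡ-+-* N 4 27))) ⟩

  -- Simulation of LK

  -- K bounds the degrees of the G-derivations simulating a single LK-rule.
  K : ℕ
  K = 100

  record Simulated (Γ Δ : List FmP) (n : ℕ) : Set where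
    field
      fits  : seqSzP Γ Δ ≤ N
      proof : G ⟦ Γ ⇒ Δ ⟧ []
      size≤ : sizeG proof ≤ n * N ^ K
  open Simulated public

  toBounded : ∀ {Γ Δ n} → Simulated Γ Δ n → Bounded ⟦ Γ ⇒ Δ ⟧ [] 5 0 (n * N ^ K)
  toBounded {Γ} {Δ} π = bounded (proof π)
    (≤-≤ⁿ-trans (≤-reflexive (cong suc (+-identityʳ _))) (1≤ⁿ0 ⊕ szUs⟦⇒⟧≤ⁿ4 Γ Δ (fits π)))
    (≤-trans (size≤ π) (m≤n+m _ (N ^ 0)))

  N^a≤c*N^K : ∀ {a} c → a ≤ K → 1 ≤ c → N ^ a ≤ c * N ^ K
  N^a≤c*N^K c a≤K 1≤c = ≤-trans (^-monoʳ-≤ N a≤K) (≤-trans (m≤m+n (N ^ K) 0) (*-monoˡ-≤ (N ^ K) 1≤c))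

  simulated₀ : ∀ {Γ Δ s a} → a ≤ K → seqSzP Γ Δ ≤ N → Bounded ⟦ Γ ⇒ Δ ⟧ [] s a 0 →
               Simulated Γ Δ (seqSzP Γ Δ)
  simulated₀ {Γ} {Δ} a≤K h (bounded d _ b) = record
    { fits = h
    ; proof = d
    ; size≤ = ≤-trans b (≤-trans (≤-reflexive (+-identityʳ _)) (N^a≤c*N^K (seqSzP Γ Δ) a≤K (s≤s z≤n)))
    }

  simulated₁ : ∀ {Γ Δ s a n} → a ≤ K → seqSzP Γ Δ ≤ N → Bounded ⟦ Γ ⇒ Δ ⟧ [] s a (n * N ^ K) →
               Simulated Γ Δ (seqSzP Γ Δ + n)
  simulated₁ {Γ} {Δ} {n = n} a≤K h (bounded d _ b) = record
    { fits = h
    ; proof = d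
    ; size≤ = ≤-trans b (≤-trans (+-monoˡ-≤ (n * N ^ K) (N^a≤c*N^K (seqSzP Γ Δ) a≤K (s≤s z≤n)))
                                 (≤-reflexive (sym (*-distribʳ-+ (N ^ K) (seqSzP Γ Δ) n))))
    }

  simulated₂ : ∀ {Γ Δ s a m n} → a ≤ K → seqSzP Γ Δ ≤ N →
               Bounded ⟦ Γ ⇒ Δ ⟧ [] s a (m * N ^ K + n * N ^ K) → Simulated Γ Δ (seqSzP Γ Δ + m + n)
  simulated₂ {Γ} {Δ} {m = m} {n} a≤K h (bounded d _ b) = record
    { fits = h
    ; proof = d
    ; size≤ = ≤-trans b (≤-trans (+-monoˡ-≤ (m * N ^ K + n * N ^ K) (N^a≤c*N^K (seqSzP Γ Δ) a≤K (s≤s z≤n)))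
                                 (≤-reflexive (sizes (seqSzP Γ Δ) m n (N ^ K))))
    }
    where
    sizes : ∀ c m n x → c * x + (m * x + n * x) ≡ (c + m + n) * x
    sizes = solve-∀

  jointContextˡ : ∀ {Γ Δ A m} Σ Λ → Simulated Γ (A ∷ Δ) m → seqSzP Σ Λ ≤ N →
                  Bounded (A ⁻ ∷ ⟦ Γ ⇒ Δ ⟧ ++ ⟦ Σ ⇒ Λ ⟧) [] 7 32 (m * N ^ K)
  jointContextˡ {Γ} {Δ} {A} Σ Λ π h =
    exᵇ (↭-trans (shift (A ⁻) ⟦ Σ ⇒ Λ ⟧ ⟦ Γ ⇒ Δ ⟧) (prep (A ⁻) (++-comm ⟦ Σ ⇒ Λ ⟧ ⟦ Γ ⇒ Δ ⟧)))
      (weakenᶜ ⟦ Σ ⇒ Λ ⟧ (IsNNF-⟦⇒⟧ Σ Λ) (szUs⟦⇒⟧≤ⁿ4 Σ Λ h) ≤-compute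
        (exᵇ (⁻-to-front (A ⁻) Γ Δ) (toBounded π)))

  jointContextʳ : ∀ {Σ Λ B n} Γ Δ → seqSzP Γ Δ ≤ N → Simulated (B ∷ Σ) Λ n →
                  Bounded (B ⁺ ∷ ⟦ Γ ⇒ Δ ⟧ ++ ⟦ Σ ⇒ Λ ⟧) [] 7 32 (n * N ^ K)
  jointContextʳ {Σ} {Λ} {B} Γ Δ h ρ =
    exᵇ (shift (B ⁺) ⟦ Γ ⇒ Δ ⟧ ⟦ Σ ⇒ Λ ⟧)
      (weakenᶜ ⟦ Γ ⇒ Δ ⟧ (IsNNF-⟦⇒⟧ Γ Δ) (szUs⟦⇒⟧≤ⁿ4 Γ Δ h) ≤-compute (toBounded ρ))

  simulate-ax : ∀ A → seqSzP (A ∷ []) (A ∷ []) ≤ N → Simulated (A ∷ []) (A ∷ []) (seqSzP (A ∷ []) (A ∷ []))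
  simulate-ax A h = simulated₀ ≤-compute h (contradiction (dual⁺⁻ A) (szU⁺≤ⁿ4 A hA) (szU⁻≤ⁿ4 A hA))
    where hA = ≤-trans (szP≤seqSzPˡ A [] (A ∷ [])) h

  simulate-ax⊤ : ∀ Γ Δ → seqSzP Γ (⊤P ∷ Δ) ≤ N → Simulated Γ (⊤P ∷ Δ) (seqSzP Γ (⊤P ∷ Δ))
  simulate-ax⊤ Γ Δ h = simulated₀ ≤-compute h
    (exᵇ (↭-trans (↭-sym (∷↭∷ʳ 0U ⟦ Γ ⇒ Δ ⟧)) (↭-sym (⁻-to-front 0U Γ Δ)))
      (weakenᶜ ⟦ Γ ⇒ Δ ⟧ (IsNNF-⟦⇒⟧ Γ Δ) (szUs⟦⇒⟧≤ⁿ4 Γ Δ (≤-trans (seqSzP≤seqSzP-∷ʳ Γ ⊤P Δ) h)) ≤-compute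
        (initialᵇ ax0 refl ≤-compute)))

  simulate-ax⊥ : ∀ Γ Δ → seqSzP (⊥P ∷ Γ) Δ ≤ N → Simulated (⊥P ∷ Γ) Δ (seqSzP (⊥P ∷ Γ) Δ)
  simulate-ax⊥ Γ Δ h = simulated₀ ≤-compute h
    (exᵇ (↭-sym (∷↭∷ʳ 0U ⟦ Γ ⇒ Δ ⟧))
      (weakenᶜ ⟦ Γ ⇒ Δ ⟧ (IsNNF-⟦⇒⟧ Γ Δ) (szUs⟦⇒⟧≤ⁿ4 Γ Δ (≤-trans (seqSzP≤seqSzP-∷ˡ ⊥P Γ Δ) h)) ≤-compute
        (initialᵇ ax0 refl ≤-compute)))

  simulate-ex : ∀ {Γ Γ′ Δ Δ′ n} → Γ ↭ Γ′ → Δ ↭ Δ′ → Simulated Γ Δ n → Simulated Γ′ Δ′ n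
  simulate-ex p q π = record
    { fits = subst (_≤ N) (seqSzP-↭ p q) (fits π)
    ; proof = exG (++⁺ (map⁺ _⁺ p) (map⁺ _⁻ q)) (proof π)
    ; size≤ = size≤ π
    }

  simulate-wL : ∀ {Γ Δ n} A → Simulated Γ Δ n → seqSzP (A ∷ Γ) Δ ≤ N →
                Simulated (A ∷ Γ) Δ (seqSzP (A ∷ Γ) Δ + n)
  simulate-wL {Γ} {Δ} A π h = simulated₁ ≤-compute h
    (cutᵇ 1U (weakening (IsNNF⁺ A) (head⁺≤ⁿ4 A Γ Δ h)) (L1ᵇ (toBounded π)))

  simulate-wR : ∀ {Γ Δ n} A → Simulated Γ Δ n → seqSzP Γ (A ∷ Δ) ≤ N →
                Simulated Γ (A ∷ Δ) (seqSzP Γ (A ∷ Δ) + n)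
  simulate-wR {Γ} {Δ} A π h = simulated₁ ≤-compute h (exᵇ (↭-sym (⁻-to-front (A ⁻) Γ Δ))
    (cutᵇ 1U (weakening (IsNNF⁻ A) (head⁻≤ⁿ4 Γ A Δ h)) (L1ᵇ (toBounded π))))

  simulate-cL : ∀ {Γ Δ n A} → Simulated (A ∷ A ∷ Γ) Δ n → seqSzP (A ∷ Γ) Δ ≤ N →
                Simulated (A ∷ Γ) Δ (seqSzP (A ∷ Γ) Δ + n)
  simulate-cL {Γ} {Δ} {A = A} π h = simulated₁ ≤-compute h
    (cutᵇ (A ⁺ *U A ⁺) (contraction (dual⁺⁻ A) (szU⁺≤ⁿ4 A hA) (szU⁻≤ⁿ4 A hA)) (*Lᵇ (toBounded π)))
    where hA = ≤-trans (szP≤seqSzPˡ A Γ Δ) h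

  simulate-cR : ∀ {Γ Δ n A} → Simulated Γ (A ∷ A ∷ Δ) n → seqSzP Γ (A ∷ Δ) ≤ N →
                Simulated Γ (A ∷ Δ) (seqSzP Γ (A ∷ Δ) + n)
  simulate-cR {Γ} {Δ} {A = A} π h = simulated₁ ≤-compute h (exᵇ (↭-sym (⁻-to-front (A ⁻) Γ Δ))
    (cutᵇ (A ⁻ *U A ⁻) (contraction (Dual-sym (dual⁺⁻ A)) (szU⁻≤ⁿ4 A hA) (szU⁺≤ⁿ4 A hA))
      (*Lᵇ (exᵇ (↭-trans (⁻-to-front (A ⁻) Γ (A ∷ Δ)) (prep (A ⁻) (⁻-to-front (A ⁻) Γ Δ))) (toBounded π)))))
    where hA = ≤-trans (szP≤seqSzPʳ Γ A Δ) h

  simulate-∧L₀ : ∀ {Γ Δ n A} B → Simulated (A ∷ Γ) Δ n → seqSzP ((A ∧P B) ∷ Γ) Δ ≤ N →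
                 Simulated ((A ∧P B) ∷ Γ) Δ (seqSzP ((A ∧P B) ∷ Γ) Δ + n)
  simulate-∧L₀ {Γ} {Δ} {A = A} B π h = simulated₁ ≤-compute h
    (∧L₀ᵇ (B ⁺) (≤ⁿ-operandʳ (head⁺≤ⁿ4 (A ∧P B) Γ Δ h)) (toBounded π))

  simulate-∧L₁ : ∀ {Γ Δ n B} A → Simulated (B ∷ Γ) Δ n → seqSzP ((A ∧P B) ∷ Γ) Δ ≤ N →
                 Simulated ((A ∧P B) ∷ Γ) Δ (seqSzP ((A ∧P B) ∷ Γ) Δ + n)
  simulate-∧L₁ {Γ} {Δ} {B = B} A π h = simulated₁ ≤-compute h
    (∧L₁ᵇ (A ⁺) (≤ⁿ-operandˡ (head⁺≤ⁿ4 (A ∧P B) Γ Δ h)) (toBounded π))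

  simulate-∧R : ∀ {Γ Δ A B m n} → Simulated Γ (A ∷ Δ) m → Simulated Γ (B ∷ Δ) n →
                seqSzP Γ ((A ∧P B) ∷ Δ) ≤ N → Simulated Γ ((A ∧P B) ∷ Δ) (seqSzP Γ ((A ∧P B) ∷ Δ) + m + n)
  simulate-∧R {Γ} {Δ} {A} {B} π ρ h = simulated₂ ≤-compute h (exᵇ (↭-sym (⁻-to-front ((A ∧P B) ⁻) Γ Δ))
    (∨Lᵇ (exᵇ (⁻-to-front (A ⁻) Γ Δ) (toBounded π)) (exᵇ (⁻-to-front (B ⁻) Γ Δ) (toBounded ρ))))

  simulate-∨L : ∀ {Γ Δ A B m n} → Simulated (A ∷ Γ) Δ m → Simulated (B ∷ Γ) Δ n →
                seqSzP ((A ∨P B) ∷ Γ) Δ ≤ N → Simulated ((A ∨P B) ∷ Γ) Δ (seqSzP ((A ∨P B) ∷ Γ) Δ + m + n)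
  simulate-∨L π ρ h = simulated₂ ≤-compute h (∨Lᵇ (toBounded π) (toBounded ρ))

  simulate-∨R₀ : ∀ {Γ Δ n A} B → Simulated Γ (A ∷ Δ) n → seqSzP Γ ((A ∨P B) ∷ Δ) ≤ N →
                 Simulated Γ ((A ∨P B) ∷ Δ) (seqSzP Γ ((A ∨P B) ∷ Δ) + n)
  simulate-∨R₀ {Γ} {Δ} {A = A} B π h = simulated₁ ≤-compute h (exᵇ (↭-sym (⁻-to-front ((A ∨P B) ⁻) Γ Δ))
    (∧L₀ᵇ (B ⁻) (≤ⁿ-operandʳ (head⁻≤ⁿ4 Γ (A ∨P B) Δ h)) (exᵇ (⁻-to-front (A ⁻) Γ Δ) (toBounded π))))

  simulate-∨R₁ : ∀ {Γ Δ n B} A → Simulated Γ (B ∷ Δ) n → seqSzP Γ ((A ∨P B) ∷ Δ) ≤ N →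
                 Simulated Γ ((A ∨P B) ∷ Δ) (seqSzP Γ ((A ∨P B) ∷ Δ) + n)
  simulate-∨R₁ {Γ} {Δ} {B = B} A π h = simulated₁ ≤-compute h (exᵇ (↭-sym (⁻-to-front ((A ∨P B) ⁻) Γ Δ))
    (∧L₁ᵇ (A ⁻) (≤ⁿ-operandˡ (head⁻≤ⁿ4 Γ (A ∨P B) Δ h)) (exᵇ (⁻-to-front (B ⁻) Γ Δ) (toBounded π))))

  -- (A ⇒ B)⁻ = A⁺ ∧ B⁻ is contracted and then split into A⁺ and B⁻.
  simulate-⇒R : ∀ {Γ Δ A B n} → Simulated (A ∷ Γ) (B ∷ Δ) n → seqSzP Γ ((A ⇒P B) ∷ Δ) ≤ N →
                Simulated Γ ((A ⇒P B) ∷ Δ) (seqSzP Γ ((A ⇒P B) ∷ Δ) + n)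
  simulate-⇒R {Γ} {Δ} {A} {B} π h = simulated₁ ≤-compute h (exᵇ (↭-sym (⁻-to-front ((A ⇒P B) ⁻) Γ Δ))
    (cutᵇ ((A ⇒P B) ⁻ *U (A ⇒P B) ⁻) (contraction (Dual-sym (dual⁺⁻ (A ⇒P B))) h⁻ h⁺)
      (*Lᵇ (∧L₀ᵇ (B ⁻) (≤ⁿ-operandʳ h⁻) (swapᵇ (∧L₁ᵇ (A ⁺) (≤ⁿ-operandˡ h⁻)
        (exᵇ (↭-trans (prep (A ⁺) (⁻-to-front (B ⁻) Γ Δ)) (swap (A ⁺) (B ⁻) ↭-refl)) (toBounded π))))))))
    where
    hAB = ≤-trans (szP≤seqSzPʳ Γ (A ⇒P B) Δ) h
    h⁺ = szU⁺≤ⁿ4 (A ⇒P B) hAB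
    h⁻ = szU⁻≤ⁿ4 (A ⇒P B) hAB

  simulate-⇒L : ∀ {Γ Σ Δ Λ A B m n} → Simulated Γ (A ∷ Δ) m → Simulated (B ∷ Σ) Λ n →
                seqSzP ((A ⇒P B) ∷ (Γ ++ Σ)) (Δ ++ Λ) ≤ N →
                Simulated ((A ⇒P B) ∷ (Γ ++ Σ)) (Δ ++ Λ) (seqSzP ((A ⇒P B) ∷ (Γ ++ Σ)) (Δ ++ Λ) + m + n)
  simulate-⇒L {Γ} {Σ} {Δ} {Λ} {A} {B} π ρ h = simulated₂ ≤-compute h
    (exᵇ (prep ((A ⇒P B) ⁺) (⟦⇒⟧-++ Γ Σ Δ Λ))
      (∨Lᵇ (jointContextˡ Σ Λ π (≤-trans (seqSzP≤seqSzP-∷ˡ B Σ Λ) (fits ρ)))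
           (jointContextʳ Γ Δ (≤-trans (seqSzP≤seqSzP-∷ʳ Γ A Δ) (fits π)) ρ)))

  simulate-cut : ∀ {Γ Σ Δ Λ m n} A → Simulated Γ (A ∷ Δ) m → Simulated (A ∷ Σ) Λ n →
                 seqSzP (Γ ++ Σ) (Δ ++ Λ) ≤ N → Simulated (Γ ++ Σ) (Δ ++ Λ) (seqSzP (Γ ++ Σ) (Δ ++ Λ) + m + n)
  simulate-cut {Γ} {Σ} {Δ} {Λ} A π ρ h = simulated₂ ≤-compute h
    (exᵇ (⟦⇒⟧-++ Γ Σ Δ Λ)
      (cutᵇ (A ⁻ ∨U A ⁺) (excludedMiddle (Dual-sym (dual⁺⁻ A)) (szU⁻≤ⁿ4 A hA) (szU⁺≤ⁿ4 A hA))
        (∨Lᵇ (jointContextˡ Σ Λ π (≤-trans (seqSzP≤seqSzP-∷ˡ A Σ Λ) (fits ρ)))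
             (jointContextʳ Γ Δ (≤-trans (seqSzP≤seqSzP-∷ʳ Γ A Δ) (fits π)) ρ))))
    where hA = ≤-trans (szP≤seqSzPˡ A Σ Λ) (fits ρ)

  by-unary : ∀ {Γ Δ Γ′ Δ′ m} → (Simulated Γ′ Δ′ m → seqSzP Γ Δ ≤ N → Simulated Γ Δ (seqSzP Γ Δ + m)) →
             (m ≤ N → Simulated Γ′ Δ′ m) → seqSzP Γ Δ + m ≤ N → Simulated Γ Δ (seqSzP Γ Δ + m)
  by-unary {Γ} {Δ} rule premise h = rule (premise (m+n≤o⇒n≤o (seqSzP Γ Δ) h)) (m+n≤o⇒m≤o (seqSzP Γ Δ) h)

  by-binary : ∀ {Γ Δ Γ₁ Δ₁ Γ₂ Δ₂ m n} →
              (Simulated Γ₁ Δ₁ m → Simulated Γ₂ Δ₂ n → seqSzP Γ Δ ≤ N → Simulated Γ Δ (seqSzP Γ Δ + m + n)) →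
              (m ≤ N → Simulated Γ₁ Δ₁ m) → (n ≤ N → Simulated Γ₂ Δ₂ n) →
              seqSzP Γ Δ + m + n ≤ N → Simulated Γ Δ (seqSzP Γ Δ + m + n)
  by-binary {Γ} {Δ} {m = m} rule premise₁ premise₂ h =
    rule (premise₁ (m+n+o≤p⇒n≤p (seqSzP Γ Δ) m h)) (premise₂ (m+n≤o⇒n≤o (seqSzP Γ Δ + m) h))
         (m+n+o≤p⇒m≤p (seqSzP Γ Δ) m h)

  simulate : ∀ {Γ Δ} (π : LK Γ Δ) → sizeLK π ≤ N → Simulated Γ Δ (sizeLK π)
  simulate (ax A) = simulate-ax A
  simulate (ax⊤ Γ Δ) = simulate-ax⊤ Γ Δ
  simulate (ax⊥ Γ Δ) = simulate-ax⊥ Γ Δ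
  simulate (exLK p q π) h = simulate-ex p q (simulate π h)
  simulate (wL A π) = by-unary (simulate-wL A) (simulate π)
  simulate (wR A π) = by-unary (simulate-wR A) (simulate π)
  simulate (cL π) = by-unary simulate-cL (simulate π)
  simulate (cR π) = by-unary simulate-cR (simulate π)
  simulate (∧L₀ B π) = by-unary (simulate-∧L₀ B) (simulate π)
  simulate (∧L₁ A π) = by-unary (simulate-∧L₁ A) (simulate π)
  simulate (∨R₀ B π) = by-unary (simulate-∨R₀ B) (simulate π)
  simulate (∨R₁ A π) = by-unary (simulate-∨R₁ A) (simulate π)
  simulate (⇒R π) = by-unary simulate-⇒R (simulate π)
  simulate (∧R π ρ) = by-binary simulate-∧R (simulate π) (simulate ρ)
  simulate (∨L π ρ) = by-binary simulate-∨L (simulate π) (simulate ρ)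
  simulate (⇒L π ρ) = by-binary simulate-⇒L (simulate π) (simulate ρ)
  simulate (cut A π ρ) = by-binary (simulate-cut A) (simulate π) (simulate ρ)

  -- From the translation back to nnf-formulas

  -- toU A and (toP A)⁺ differ only in that (toP (neg p))⁺ is ¬U p ∨U 0U.
  toU⇒toP⁺-linear : ∀ A → szU (toP A ⁺) ≤ⁿ 4 → Bounded (toU A ∷ []) (toP A ⁺ ∷ []) 6 0 (szU (toU A) * N ^ 20)
  toU⇒toP⁺-linear (pos p) h = close {k = 20} 0 ≤-compute (seq[ atU p ⇒ atU p ]≤ⁿ h h) z≤n (axᵇ (atU p) h)
  toU⇒toP⁺-linear (neg p) h =
    close {k = 20} 2 ≤-compute (seq[ ¬U p ⇒ ¬U p ∨U 0U ]≤ⁿ (≤ⁿ-operandˡ h) h) z≤n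
      (∨R₀ᵇ 0U 1≤ⁿ0 (axᵇ (¬U p) (≤ⁿ-operandˡ h)))
  toU⇒toP⁺-linear (A ∧N B) h =
    close₂ {k = 20} (szU (toU A)) (szU (toU B)) ≤-compute
      (seq[ toU A ∧U toU B ⇒ toP A ⁺ ∧U toP B ⁺ ]≤ⁿ (≤-≤ⁿ-trans (szU-toU≤szU-toP⁺ (A ∧N B)) h) h)
      (∧Rᵇ (∧L₀ᵇ (toU B) (≤-≤ⁿ-trans (szU-toU≤szU-toP⁺ B) hB) (toU⇒toP⁺-linear A hA))
           (∧L₁ᵇ (toU A) (≤-≤ⁿ-trans (szU-toU≤szU-toP⁺ A) hA) (toU⇒toP⁺-linear B hB)))
    where
    hA = ≤ⁿ-operandˡ h
    hB = ≤ⁿ-operandʳ h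
  toU⇒toP⁺-linear (A ∨N B) h =
    close₂ {k = 20} (szU (toU A)) (szU (toU B)) ≤-compute
      (seq[ toU A ∨U toU B ⇒ toP A ⁺ ∨U toP B ⁺ ]≤ⁿ (≤-≤ⁿ-trans (szU-toU≤szU-toP⁺ (A ∨N B)) h) h)
      (∨Lᵇ (∨R₀ᵇ (toP B ⁺) hB (toU⇒toP⁺-linear A hA)) (∨R₁ᵇ (toP A ⁺) hA (toU⇒toP⁺-linear B hB)))
    where
    hA = ≤ⁿ-operandˡ h
    hB = ≤ⁿ-operandʳ h

  toU⇒toP⁺ : ∀ A → szU (toP A ⁺) ≤ⁿ 4 → Bounded (toU A ∷ []) (toP A ⁺ ∷ []) 6 25 0
  toU⇒toP⁺ A h = localize (≤-≤ⁿ-trans (szU-toU≤szU-toP⁺ A) h) (toU⇒toP⁺-linear A h)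

  toP⁺⇒toU-linear : ∀ A → szU (toP A ⁺) ≤ⁿ 4 → Bounded (toP A ⁺ ∷ []) (toU A ∷ []) 6 0 (szU (toU A) * N ^ 20)
  toP⁺⇒toU-linear (pos p) h = close {k = 20} 0 ≤-compute (seq[ atU p ⇒ atU p ]≤ⁿ h h) z≤n (axᵇ (atU p) h)
  toP⁺⇒toU-linear (neg p) h =
    close {k = 20} 2 ≤-compute (seq[ ¬U p ∨U 0U ⇒ ¬U p ]≤ⁿ h (≤ⁿ-operandˡ h)) z≤n
      (∨Lᵇ (axᵇ (¬U p) (≤ⁿ-operandˡ h)) (initialᵇ (z-np p) refl ≤-compute))
  toP⁺⇒toU-linear (A ∧N B) h =
    close₂ {k = 20} (szU (toU A)) (szU (toU B)) ≤-compute
      (seq[ toP A ⁺ ∧U toP B ⁺ ⇒ toU A ∧U toU B ]≤ⁿ h (≤-≤ⁿ-trans (szU-toU≤szU-toP⁺ (A ∧N B)) h))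
      (∧Rᵇ (∧L₀ᵇ (toP B ⁺) hB (toP⁺⇒toU-linear A hA)) (∧L₁ᵇ (toP A ⁺) hA (toP⁺⇒toU-linear B hB)))
    where
    hA = ≤ⁿ-operandˡ h
    hB = ≤ⁿ-operandʳ h
  toP⁺⇒toU-linear (A ∨N B) h =
    close₂ {k = 20} (szU (toU A)) (szU (toU B)) ≤-compute
      (seq[ toP A ⁺ ∨U toP B ⁺ ⇒ toU A ∨U toU B ]≤ⁿ h (≤-≤ⁿ-trans (szU-toU≤szU-toP⁺ (A ∨N B)) h))
      (∨Lᵇ (∨R₀ᵇ (toU B) (≤-≤ⁿ-trans (szU-toU≤szU-toP⁺ B) hB) (toP⁺⇒toU-linear A hA))
           (∨R₁ᵇ (toU A) (≤-≤ⁿ-trans (szU-toU≤szU-toP⁺ A) hA) (toP⁺⇒toU-linear B hB)))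
    where
    hA = ≤ⁿ-operandˡ h
    hB = ≤ⁿ-operandʳ h

  toP⁺⇒toU : ∀ A → szU (toP A ⁺) ≤ⁿ 4 → Bounded (toP A ⁺ ∷ []) (toU A ∷ []) 6 25 0
  toP⁺⇒toU A h = localize (≤-≤ⁿ-trans (szU-toU≤szU-toP⁺ A) h) (toP⁺⇒toU-linear A h)

  convertAll : ∀ {Λ} Γ R → szUs (map _⁺ (map toP Γ)) ≤ⁿ 4 →
               G (map _⁺ (map toP Γ) ++ R) Λ → G (map toU Γ ++ R) Λ
  convertAll [] R h d = d
  convertAll (A ∷ Γ) R h d =
    cut (toP A ⁺) (derivation (toU⇒toP⁺ A (≤-≤ⁿ-trans (m≤m+n _ _) h)))
      (exG (shift (toP A ⁺) (map toU Γ) R)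
        (convertAll Γ (toP A ⁺ ∷ R) (≤-≤ⁿ-trans (m≤n+m _ _) h)
          (exG (↭-sym (shift (toP A ⁺) (map _⁺ (map toP Γ)) R)) d)))

  size-convertAll : ∀ {Λ} t Γ R (h : szUs (map _⁺ (map toP Γ)) ≤ⁿ 4) (d : G (map _⁺ (map toP Γ) ++ R) Λ) →
                    seqSzU (map _⁺ (map toP Γ) ++ R) Λ ≤ N ^ t →
                    sizeG (convertAll Γ R h d) ≤ length Γ * (N ^ t + (N ^ 25 + 0)) + sizeG d
  size-convertAll t [] R h d q = ≤-refl
  size-convertAll {Λ} t (A ∷ Γ) R h d q = begin
    seqSzU (map toU (A ∷ Γ) ++ R) Λ + sizeG c + sizeG (convertAll Γ (X ∷ R) hΓ d′)
      ≤⟨ +-mono-≤ (+-mono-≤ (≤-trans (seqSzU-toU≤seqSzU-toP⁺ (A ∷ Γ) R Λ) q) (size≤ (toU⇒toP⁺ A hA)))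
                  (size-convertAll t Γ (X ∷ R) hΓ d′ q′) ⟩
    N ^ t + (N ^ 25 + 0) + (length Γ * C + sizeG d)
      ≡⟨ sizes (N ^ t) (N ^ 25 + 0) (length Γ) (sizeG d) ⟩
    length (A ∷ Γ) * C + sizeG d ∎
    where
    open ≤-Reasoning
    X = toP A ⁺
    C = N ^ t + (N ^ 25 + 0)
    hA = ≤-≤ⁿ-trans (m≤m+n _ _) h
    hΓ = ≤-≤ⁿ-trans (m≤n+m _ _) h
    c = derivation (toU⇒toP⁺ A hA)
    d′ = exG (↭-sym (shift X (map _⁺ (map toP Γ)) R)) d
    q′ : seqSzU (map _⁺ (map toP Γ) ++ X ∷ R) Λ ≤ N ^ t
    q′ = ≤-trans (≤-reflexive (seqSzU-↭ˡ Λ (shift X (map _⁺ (map toP Γ)) R))) q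
    sizes : ∀ n o l g → n + o + (l * (n + o) + g) ≡ suc l * (n + o) + g
    sizes = solve-∀

  convertᶜ : ∀ {Λ R s a Y} Γ → szUs (map _⁺ (map toP Γ)) ≤ⁿ 4 → s ≤ 10 →
             Bounded (map _⁺ (map toP Γ) ++ R) Λ s a Y → Bounded (map toU Γ ++ R) Λ 10 (suc (30 ⊔ a)) Y
  convertᶜ {Λ} {R} {a = a} {Y} Γ h s≤10 (bounded d q b) =
    bounded (convertAll Γ R h d) (≤-≤ⁿ-trans (seqSzU-toU≤seqSzU-toP⁺ Γ R Λ) q′)
      (≤-trans (size-convertAll 10 Γ R h d (≤ⁿ⇒≤ q′)) (size-unary {a = a} {Y} cost b))
    where
    q′ = ≤ⁿ-raise s≤10 q
    C≤ⁿ26 : N ^ 10 + (N ^ 25 + 0) ≤ⁿ 26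
    C≤ⁿ26 = N^i≤ⁿi 10 ⊕ ≤-≤ⁿ-trans (≤-reflexive (+-identityʳ _)) (N^i≤ⁿi 25)
    cost : length Γ * (N ^ 10 + (N ^ 25 + 0)) ≤ⁿ 30
    cost = ⟨ ≤-trans (*-mono-≤ (≤ⁿ⇒≤ (≤-≤ⁿ-trans (length≤szUs-toP⁺ Γ) h)) (≤ⁿ⇒≤ C≤ⁿ26))
                     (≤-reflexive (sym (^-distribˡ-+-* N 4 26))) ⟩

  dual-to-succedent : ∀ {W X X′ Y} → All IsNNF W → szUs W ≤ⁿ 4 → Dual X X′ → szU X ≤ⁿ 4 → szU X′ ≤ⁿ 4 →
                      Bounded (W ++ X′ ∷ []) [] 5 0 Y → Bounded W (X ∷ []) 9 47 Y
  dual-to-succedent {W} {X} {X′} {Y} nW hW d h h′ b =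
    relax ≤-refl ≤-refl (≤-reflexive (+-identityʳ Y)) (cutᵇ (X ∨U X′) (excludedMiddle d h h′) (∨Lᵇ caseX caseX′))
    where
    caseX = exᵇ (↭-sym (∷↭∷ʳ X W)) (weakenᶜ W nW hW ≤-compute (axᵇ X h))
    caseX′ = exᵇ (↭-reflexive (++-identityʳ (X′ ∷ W)))
               (cutᵇ 0U (R0ᵇ (exᵇ (↭-sym (∷↭∷ʳ X′ W)) b)) (exFalso (Dual⇒IsNNF d) h))

  size≤N^102 : ∀ {Γ Δ s a X} → a ≤ 101 → X ≤ N ^ 101 → Bounded Γ Δ s a X → Σ (G Γ Δ) λ σ → sizeG σ ≤ N ^ 102
  size≤N^102 {a = a} {X} a≤ X≤ (bounded d _ b) = d , ≤-trans b (≤ⁿ⇒≤ (N^a≤ⁿ101 ⊕ X≤ⁿ101))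
    where
    N^a≤ⁿ101 : N ^ a ≤ⁿ 101
    N^a≤ⁿ101 = ⟨ ^-monoʳ-≤ N a≤ ⟩
    X≤ⁿ101 : X ≤ⁿ 101
    X≤ⁿ101 = ⟨ X≤ ⟩

  translate : ∀ Γ Δ → length Δ ≤ 1 → (π : LK (map toP Γ) (map toP Δ)) → sizeLK π ≤ N →
              Σ (G (map toU Γ) (map toU Δ)) λ σ → sizeG σ ≤ N ^ 102
  translate Γ [] _ π h = size≤N^102 ≤-compute (*-monoˡ-≤ (N ^ K) h)
    (exᵇ (↭-reflexive (++-identityʳ (map toU Γ)))
      (convertᶜ Γ (szUs-map⁺≤ⁿ4 (map toP Γ) [] (fits σ)) ≤-compute (toBounded σ)))
    where σ = simulate π h
  translate Γ (D ∷ []) _ π h = size≤N^102 ≤-compute (≤-trans (≤-reflexive (+-identityʳ _)) (*-monoˡ-≤ (N ^ K) h))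
    (exᵇ (↭-reflexive (++-identityʳ (map toU Γ)))
      (convertᶜ Γ hΓ ≤-compute
        (cutᵇ (toP D ⁺)
          (dual-to-succedent (IsNNF-map⁺ (map toP Γ)) hΓ (dual⁺⁻ (toP D)) hD⁺ (szU⁻≤ⁿ4 (toP D) hD) (toBounded σ))
          (toP⁺⇒toU D hD⁺))))
    where
    σ = simulate π h
    hΓ = szUs-map⁺≤ⁿ4 (map toP Γ) (toP D ∷ []) (fits σ)
    hD = ≤-trans (szP≤seqSzPʳ (map toP Γ) (toP D) []) (fits σ)
    hD⁺ = szU⁺≤ⁿ4 (toP D) hD
  translate Γ (_ ∷ _ ∷ _) (s≤s ()) π h

2≤sizeLK : ∀ {Γ Δ} (π : LK Γ Δ) → 2 ≤ sizeLK π
2≤sizeLK (ax A) = s≤s (≤-trans (1≤szP A) (≤-trans (m≤m+n _ _) (m≤m+n _ _)))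
2≤sizeLK (ax⊤ Γ Δ) = s≤s (≤-trans (s≤s z≤n) (m≤n+m _ (szPs Γ)))
2≤sizeLK (ax⊥ Γ Δ) = s≤s (s≤s z≤n)
2≤sizeLK (exLK p q π) = 2≤sizeLK π
2≤sizeLK (wL _ π) = ≤-trans (2≤sizeLK π) (m≤n+m _ _)
2≤sizeLK (wR _ π) = ≤-trans (2≤sizeLK π) (m≤n+m _ _)
2≤sizeLK (cL π) = ≤-trans (2≤sizeLK π) (m≤n+m _ _)
2≤sizeLK (cR π) = ≤-trans (2≤sizeLK π) (m≤n+m _ _)
2≤sizeLK (∧L₀ _ π) = ≤-trans (2≤sizeLK π) (m≤n+m _ _)
2≤sizeLK (∧L₁ _ π) = ≤-trans (2≤sizeLK π) (m≤n+m _ _)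
2≤sizeLK {Γ} {Δ} (∧R π ρ) =
  ≤-trans (2≤sizeLK π) (≤-trans (m≤n+m (sizeLK π) (seqSzP Γ Δ)) (m≤m+n _ (sizeLK ρ)))
2≤sizeLK {Γ} {Δ} (∨L π ρ) =
  ≤-trans (2≤sizeLK π) (≤-trans (m≤n+m (sizeLK π) (seqSzP Γ Δ)) (m≤m+n _ (sizeLK ρ)))
2≤sizeLK (∨R₀ _ π) = ≤-trans (2≤sizeLK π) (m≤n+m _ _)
2≤sizeLK (∨R₁ _ π) = ≤-trans (2≤sizeLK π) (m≤n+m _ _)
2≤sizeLK {Γ} {Δ} (⇒L π ρ) =
  ≤-trans (2≤sizeLK π) (≤-trans (m≤n+m (sizeLK π) (seqSzP Γ Δ)) (m≤m+n _ (sizeLK ρ)))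
2≤sizeLK (⇒R π) = ≤-trans (2≤sizeLK π) (m≤n+m _ _)
2≤sizeLK {Γ} {Δ} (cut _ π ρ) =
  ≤-trans (2≤sizeLK π) (≤-trans (m≤n+m (sizeLK π) (seqSzP Γ Δ)) (m≤m+n _ (sizeLK ρ)))

corollary37 : ∃ λ (c : ℕ) → (Γ Δ : List NNF) → length Δ ≤ 1 →
    (π : LK (map toP Γ) (map toP Δ)) →
    Σ (G (map toU Γ) (map toU Δ)) λ σ → sizeG σ ≤ sizeLK π ^ c
corollary37 = 102 , λ Γ Δ |Δ|≤1 π → Simulation.translate (sizeLK π) (2≤sizeLK π) Γ Δ |Δ|≤1 π ≤-refl
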